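{- Let $\mathbb{S},\mathbb{T}$ be theories of the $\lambda\Pi$-calculus modulo rewriting, $\mu_1,\ldots,\mu_n$ theory morphisms from $\mathbb{S}$ to $\mathbb{T}$, and $\lambda$ a logical relation on $\mu_1,\ldots,\mu_n$. 1. If $A\equiv B$ in $\mathbb{S}$ for types $A,B$, then $\lambda(A)\equiv\lambda(B)$ in $\mathbb{T}$. 2. If $K\equiv K'$ in $\mathbb{S}$ for kinds $K,K'$, then $\lambda^{R}(K)\equiv\lambda^{R}(K')$ in $\mathbb{T}$ (for any term $R$).
   Context: Syntax of $\lambda\Pi/\mathcal{R}$: objects $M,N ::= c \mid x \mid \lambda x:A.\,M \mid M\,N$; types $A,B ::= a \mid \Pi x:A.\,B \mid \lambda x:A.\,B \mid A\,M$; kinds $K ::= \mathsf{Type} \mid \Pi x:A.\,K$; plus $\mathsf{Kind}$; terms quotiented by $\alpha$-equality; substitutions $\theta$ with capture-avoiding application. A theory is a finite sequence of declarations $c:A$, $a:K$ and rewrite rules $\ell\hookrightarrow r$. Conversion in a theory: $\hookrightarrow_{\beta\mathcal{R}}$ (resp. $\hookrightarrow_{\beta\eta\mathcal{R}}$) is the smallest relation closed under term constructors and substitutions generated by $\beta$-reduction (resp. also $\eta$-expansion) and the theory's rewrite rules; $\equiv$ is its reflexive, symmetric, transitive closure, the variant being fixed globally (the result holds for either). Typing $\vdash_\mathbb{T}$ is standard LF typing with conversion modulo $\equiv$. Theory morphism $\mu:\mathbb{S}\to\mathbb{T}$: from terms $\mu_c,\mu_a$, $\mu$ is the homomorphic extension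 ($\mu(x)=x$, $\mu(c)=\mu_c$, $\mu(a)=\mu_a$, commuting with application, $\lambda$, $\Pi$, fixing $\mathsf{Type},\mathsf{Kind}$) such that $\vdash_\mathbb{T}\mu_c:\mu(A)$ for $c:A\in\mathbb{S}$, $\vdash_\mathbb{T}\mu_a:\mu(K)$ for $a:K\in\mathbb{S}$, and $\mu(\ell)\equiv\mu(r)$ in $\mathbb{T}$ for each rule of $\mathbb{S}$. Logical relations: each $\mu_i$ renames variable $x$ to $x_i$, and $x^*$ is a further fresh companion of $x$. Notation: iterated binders $\lambda\vec x:\vec\mu(A)$, $\Pi\vec x:\vec\mu(A)$ over $x_1:\mu_1(A),\ldots,x_n:\mu_n(A)$; $\vec\mu(A)\to t$ is $\mu_1(A)\to\cdots\to\mu_n(A)\to t$; $t\,\vec\mu(M)=t\,\mu_1(M)\cdots\mu_n(M)$. Given terms $\lambda_c,\lambda_a$: $\lambda(x)=x^*$; $\lambda(c)=\lambda_c$; $\lambda(a)=\lambda_a$; $\lambda(M\,N)=\lambda(M)\,\vec\mu(N)\,\lambda(N)$; $\lambda(A\,M)=\lambda(A)\,\vec\mu(M)\,\lambda(M)$; $\lambda(\lambda x:A.t)=\lambda\vec x:\vec\mu(A).\lambda x^*:\lambda(A)\,\vec x.\lambda(t)$; $\lambda(\Pi x:A.B)=\lambda\vec f:\vec\mu(\Pi x:A.B).\Pi\vec x:\vec\mu(A).\Pi x^*:\lambda(A)\,\vec x.\lambda(B)\,(f_1x_1)\cdots(f_nx_n)$; $\lambda^R(\Pi x:A.K)=\Pi\vec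 x:\vec\mu(A).\Pi x^*:\lambda(A)\,\vec x.\lambda^{R\,x}(K)$; $\lambda^R(\mathsf{Type})=\vec\mu(R)\to\mathsf{Type}$; $\lambda(\mathsf{Kind})=\mathsf{Kind}$; on substitutions $\lambda(\varnothing)=\varnothing$, $\lambda(\theta,x\leftarrow N)=\lambda(\theta),x_1\leftarrow\mu_1(N),\ldots,x_n\leftarrow\mu_n(N),x^*\leftarrow\lambda(N)$. $\lambda$ is a logical relation on $\mu_1,\ldots,\mu_n$ when $\vdash_\mathbb{T}\lambda_c:\lambda(A)\,\vec\mu(c)$ for $c:A\in\mathbb{S}$, $\vdash_\mathbb{T}\lambda_a:\lambda^a(K)$ for $a:K\in\mathbb{S}$, and $\lambda(\ell)\equiv\lambda(r)$ in $\mathbb{T}$ for every rule $\ell\hookrightarrow r\in\mathbb{S}$. -}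

module Defs where

open import Data.Nat using (ℕ; zero; suc; _+_)
open import Data.Fin using (Fin; zero; suc; _↑ʳ_; _↑ˡ_; inject₁; fromℕ; opposite)
open import Data.List using (List)
open import Data.List.Membership.Propositional using (_∈_)
open import Relation.Binary.PropositionalEquality using (_≡_)
open import Relation.Binary.Construct.Closure.Equivalence using (EqClosure)
open import Function using (_∘_; id)

-- Syntax of λΠ/R, well-scoped de Bruijn representation (α-equality is
-- syntactic equality).  A signature fixes how many object constants c
-- and type constants a there are.  Terms are indexed by the number of
-- free (object) variables in scope; index zero = most recently bound.

record Sig : Set where
  field
    nc : ℕ
    na : ℕ
open Sig public

data Obj (Σ : Sig) : ℕ → Set
data Ty (Σ : Sig) : ℕ → Set

data Obj Σ where
  var : ∀ {k} → Fin k → Obj Σ k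
  con : ∀ {k} → Fin (nc Σ) → Obj Σ k
  lam : ∀ {k} → Ty Σ k → Obj Σ (suc k) → Obj Σ k
  app : ∀ {k} → Obj Σ k → Obj Σ k → Obj Σ k

data Ty Σ where
  tcon : ∀ {k} → Fin (na Σ) → Ty Σ k
  Pi   : ∀ {k} → Ty Σ k → Ty Σ (suc k) → Ty Σ k
  tlam : ∀ {k} → Ty Σ k → Ty Σ (suc k) → Ty Σ k
  tapp : ∀ {k} → Ty Σ k → Obj Σ k → Ty Σ k

data Kd (Σ : Sig) : ℕ → Set where
  Type : ∀ {k} → Kd Σ k
  KPi  : ∀ {k} → Ty Σ k → Kd Σ (suc k) → Kd Σ k

Ren : ℕ → ℕ → Set
Ren k k' = Fin k → Fin k'

ext : ∀ {k k'} → Ren k k' → Ren (suc k) (suc k')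
ext ρ zero    = zero
ext ρ (suc i) = suc (ρ i)

module _ {Σ : Sig} where

  renO : ∀ {k k'} → Ren k k' → Obj Σ k → Obj Σ k'
  renT : ∀ {k k'} → Ren k k' → Ty Σ k → Ty Σ k'

  renO ρ (var i)   = var (ρ i)
  renO ρ (con c)   = con c
  renO ρ (lam A M) = lam (renT ρ A) (renO (ext ρ) M)
  renO ρ (app M N) = app (renO ρ M) (renO ρ N)

  renT ρ (tcon a)   = tcon a
  renT ρ (Pi A B)   = Pi (renT ρ A) (renT (ext ρ) B)
  renT ρ (tlam A B) = tlam (renT ρ A) (renT (ext ρ) B)
  renT ρ (tapp A M) = tapp (renT ρ A) (renO ρ M)

  renK : ∀ {k k'} → Ren k k' → Kd Σ k → Kd Σ k'
  renK ρ Type      = Type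
  renK ρ (KPi A K) = KPi (renT ρ A) (renK (ext ρ) K)

  wk0O : ∀ {k} → Obj Σ 0 → Obj Σ k
  wk0O = renO (λ ())

  wk0T : ∀ {k} → Ty Σ 0 → Ty Σ k
  wk0T = renT (λ ())

  wk0K : ∀ {k} → Kd Σ 0 → Kd Σ k
  wk0K = renK (λ ())

  Sub : ℕ → ℕ → Set
  Sub k k' = Fin k → Obj Σ k'

  exts : ∀ {k k'} → Sub k k' → Sub (suc k) (suc k')
  exts σ zero    = var zero
  exts σ (suc i) = renO suc (σ i)

  subO : ∀ {k k'} → Sub k k' → Obj Σ k → Obj Σ k'
  subT : ∀ {k k'} → Sub k k' → Ty Σ k → Ty Σ k'

  subO σ (var i)   = σ i
  subO σ (con c)   = con c
  subO σ (lam A M) = lam (subT σ A) (subO (exts σ) M)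
  subO σ (app M N) = app (subO σ M) (subO σ N)

  subT σ (tcon a)   = tcon a
  subT σ (Pi A B)   = Pi (subT σ A) (subT (exts σ) B)
  subT σ (tlam A B) = tlam (subT σ A) (subT (exts σ) B)
  subT σ (tapp A M) = tapp (subT σ A) (subO σ M)

  subK : ∀ {k k'} → Sub k k' → Kd Σ k → Kd Σ k'
  subK σ Type      = Type
  subK σ (KPi A K) = KPi (subT σ A) (subK (exts σ) K)

  sg : ∀ {k} → Obj Σ k → Sub (suc k) k
  sg N zero    = N
  sg N (suc i) = var i

-- Theories: declarations c : A, a : K (closed) and rewrite rules ℓ ↪ r.
-- A rule has m pattern (object) variables; rules are at object level or
-- at type level.

data Rule (Σ : Sig) : Set where
  orule : (m : ℕ) → Obj Σ m → Obj Σ m → Rule Σ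
  trule : (m : ℕ) → Ty Σ m → Ty Σ m → Rule Σ

record Theory : Set where
  field
    sig   : Sig
    ctype : Fin (nc sig) → Ty sig 0
    akind : Fin (na sig) → Kd sig 0
    rules : List (Rule sig)
open Theory public

-- The globally fixed variant of conversion: ↪βR or ↪βηR.
data Variant : Set where
  βR βηR : Variant

module Conv (v : Variant) (Th : Theory) where

  private
    Σ = sig Th

  data _↪O_ : ∀ {k} → Obj Σ k → Obj Σ k → Set
  data _↪T_ : ∀ {k} → Ty Σ k → Ty Σ k → Set

  data _↪O_ where
    β     : ∀ {k} {A : Ty Σ k} {M N} → app (lam A M) N ↪O subO (sg N) M
    η     : ∀ {k} (A : Ty Σ k) {M} → v ≡ βηR →
            M ↪O lam A (app (renO suc M) (var zero))
    rule  : ∀ {k m} {l r : Obj Σ m} → orule m l r ∈ rules Th →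
            (σ : Sub m k) → subO σ l ↪O subO σ r
    lamA  : ∀ {k} {A A' : Ty Σ k} {M} → A ↪T A' → lam A M ↪O lam A' M
    lamM  : ∀ {k} {A : Ty Σ k} {M M'} → M ↪O M' → lam A M ↪O lam A M'
    appL  : ∀ {k} {M M' N : Obj Σ k} → M ↪O M' → app M N ↪O app M' N
    appR  : ∀ {k} {M N N' : Obj Σ k} → N ↪O N' → app M N ↪O app M N'

  data _↪T_ where
    β     : ∀ {k} {A : Ty Σ k} {B N} → tapp (tlam A B) N ↪T subT (sg N) B
    η     : ∀ {k} (A : Ty Σ k) {B} → v ≡ βηR →
            B ↪T tlam A (tapp (renT suc B) (var zero))
    rule  : ∀ {k m} {l r : Ty Σ m} → trule m l r ∈ rules Th →
            (σ : Sub m k) → subT σ l ↪T subT σ r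
    PiA   : ∀ {k} {A A' : Ty Σ k} {B} → A ↪T A' → Pi A B ↪T Pi A' B
    PiB   : ∀ {k} {A : Ty Σ k} {B B'} → B ↪T B' → Pi A B ↪T Pi A B'
    tlamA : ∀ {k} {A A' : Ty Σ k} {B} → A ↪T A' → tlam A B ↪T tlam A' B
    tlamB : ∀ {k} {A : Ty Σ k} {B B'} → B ↪T B' → tlam A B ↪T tlam A B'
    tappL : ∀ {k} {A A' : Ty Σ k} {M} → A ↪T A' → tapp A M ↪T tapp A' M
    tappR : ∀ {k} {A : Ty Σ k} {M M'} → M ↪O M' → tapp A M ↪T tapp A M'

  data _↪K_ : ∀ {k} → Kd Σ k → Kd Σ k → Set where
    KPiA : ∀ {k} {A A' : Ty Σ k} {K} → A ↪T A' → KPi A K ↪K KPi A' K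
    KPiK : ∀ {k} {A : Ty Σ k} {K K'} → K ↪K K' → KPi A K ↪K KPi A K'

  _≡O_ : ∀ {k} → Obj Σ k → Obj Σ k → Set
  _≡O_ {k} = EqClosure (_↪O_ {k})

  _≡T_ : ∀ {k} → Ty Σ k → Ty Σ k → Set
  _≡T_ {k} = EqClosure (_↪T_ {k})

  _≡K_ : ∀ {k} → Kd Σ k → Kd Σ k → Set
  _≡K_ {k} = EqClosure (_↪K_ {k})

data Ctx (Σ : Sig) : ℕ → Set where
  ε   : Ctx Σ 0
  _▸_ : ∀ {k} → Ctx Σ k → Ty Σ k → Ctx Σ (suc k)

lookupCtx : ∀ {Σ k} → Ctx Σ k → Fin k → Ty Σ k
lookupCtx (Γ ▸ A) zero    = renT suc A
lookupCtx (Γ ▸ A) (suc i) = renT suc (lookupCtx Γ i)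

module Typing (v : Variant) (Th : Theory) where

  private
    Σ = sig Th
  open Conv v Th

  data ⊢_ctx : ∀ {k} → Ctx Σ k → Set
  data _⊢_kind : ∀ {k} → Ctx Σ k → Kd Σ k → Set
  data _⊢_∶K_ : ∀ {k} → Ctx Σ k → Ty Σ k → Kd Σ k → Set
  data _⊢_∶_ : ∀ {k} → Ctx Σ k → Obj Σ k → Ty Σ k → Set

  data ⊢_ctx where
    ctx-ε : ⊢ ε ctx
    ctx-▸ : ∀ {k} {Γ : Ctx Σ k} {A} → ⊢ Γ ctx → Γ ⊢ A ∶K Type → ⊢ (Γ ▸ A) ctx

  data _⊢_kind where
    k-Type : ∀ {k} {Γ : Ctx Σ k} → ⊢ Γ ctx → Γ ⊢ Type kind
    k-Pi   : ∀ {k} {Γ : Ctx Σ k} {A K} → Γ ⊢ A ∶K Type → (Γ ▸ A) ⊢ K kind →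
             Γ ⊢ KPi A K kind

  data _⊢_∶K_ where
    t-con  : ∀ {k} {Γ : Ctx Σ k} (a : Fin (na Σ)) → ⊢ Γ ctx →
             Γ ⊢ tcon a ∶K wk0K (akind Th a)
    t-Pi   : ∀ {k} {Γ : Ctx Σ k} {A B} → Γ ⊢ A ∶K Type → (Γ ▸ A) ⊢ B ∶K Type →
             Γ ⊢ Pi A B ∶K Type
    t-lam  : ∀ {k} {Γ : Ctx Σ k} {A B K} → Γ ⊢ A ∶K Type → (Γ ▸ A) ⊢ B ∶K K →
             Γ ⊢ tlam A B ∶K KPi A K
    t-app  : ∀ {k} {Γ : Ctx Σ k} {A B K M} → Γ ⊢ A ∶K KPi B K → Γ ⊢ M ∶ B →
             Γ ⊢ tapp A M ∶K subK (sg M) K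
    t-conv : ∀ {k} {Γ : Ctx Σ k} {A K K'} → Γ ⊢ A ∶K K → Γ ⊢ K' kind → K ≡K K' →
             Γ ⊢ A ∶K K'

  data _⊢_∶_ where
    o-con  : ∀ {k} {Γ : Ctx Σ k} (c : Fin (nc Σ)) → ⊢ Γ ctx →
             Γ ⊢ con c ∶ wk0T (ctype Th c)
    o-var  : ∀ {k} {Γ : Ctx Σ k} (i : Fin k) → ⊢ Γ ctx → Γ ⊢ var i ∶ lookupCtx Γ i
    o-lam  : ∀ {k} {Γ : Ctx Σ k} {A M B} → Γ ⊢ A ∶K Type → (Γ ▸ A) ⊢ M ∶ B →
             Γ ⊢ lam A M ∶ Pi A B
    o-app  : ∀ {k} {Γ : Ctx Σ k} {M N A B} → Γ ⊢ M ∶ Pi A B → Γ ⊢ N ∶ A →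
             Γ ⊢ app M N ∶ subT (sg N) B
    o-conv : ∀ {k} {Γ : Ctx Σ k} {M A B} → Γ ⊢ M ∶ A → Γ ⊢ B ∶K Type → A ≡T B →
             Γ ⊢ M ∶ B

-- It is defined relative to a
-- renaming of variables (identity at top level: μ(x) = x); the renaming
-- is needed to express μ_i, which renames x to x_i, inside λ.

module Hom {Σ Σ' : Sig} (mc : Fin (nc Σ) → Obj Σ' 0) (ma : Fin (na Σ) → Ty Σ' 0) where

  mO : ∀ {k k'} → Ren k k' → Obj Σ k → Obj Σ' k'
  mT : ∀ {k k'} → Ren k k' → Ty Σ k → Ty Σ' k'

  mO ρ (var i)   = var (ρ i)
  mO ρ (con c)   = wk0O (mc c)
  mO ρ (lam A M) = lam (mT ρ A) (mO (ext ρ) M)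
  mO ρ (app M N) = app (mO ρ M) (mO ρ N)

  mT ρ (tcon a)   = wk0T (ma a)
  mT ρ (Pi A B)   = Pi (mT ρ A) (mT (ext ρ) B)
  mT ρ (tlam A B) = tlam (mT ρ A) (mT (ext ρ) B)
  mT ρ (tapp A M) = tapp (mT ρ A) (mO ρ M)

  mK : ∀ {k k'} → Ren k k' → Kd Σ k → Kd Σ' k'
  mK ρ Type      = Type
  mK ρ (KPi A K) = KPi (mT ρ A) (mK (ext ρ) K)

  PresRule : Variant → (T : Theory) → sig T ≡ Σ' → Rule Σ → Set
  PresRule v T _≡_.refl (orule m l r) = Conv._≡O_ v T (mO id l) (mO id r)
  PresRule v T _≡_.refl (trule m l r) = Conv._≡T_ v T (mT id l) (mT id r)

record Morphism (v : Variant) (S T : Theory) : Set where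
  field
    mc : Fin (nc (sig S)) → Obj (sig T) 0
    ma : Fin (na (sig S)) → Ty (sig T) 0
    mc-typed : ∀ c → Typing._⊢_∶_ v T ε (mc c) (Hom.mT mc ma id (ctype S c))
    ma-typed : ∀ a → Typing._⊢_∶K_ v T ε (ma a) (Hom.mK mc ma id (akind S a))
    rules-pres : ∀ {ρ} → ρ ∈ rules S → Hom.PresRule mc ma v T _≡_.refl ρ
open Morphism public

data Tel (Σ : Sig) (k : ℕ) : ℕ → Set where
  []  : Tel Σ k 0
  _▷_ : ∀ {m} → Tel Σ k m → Ty Σ (m + k) → Tel Σ k (suc m)

-- telescope whose j-th entry is built (via a renaming of the base scope
-- into the scope after the first j entries) by f j
mkTel : ∀ {Σ k} m → ((j : Fin m) → ∀ {k''} → Ren k k'' → Ty Σ k'') → Tel Σ k m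
mkTel zero    f = []
mkTel (suc m) f = mkTel m (λ j → f (inject₁ j)) ▷ f (fromℕ m) (m ↑ʳ_)

module _ {Σ : Sig} where

  lamsO : ∀ {k m} → Tel Σ k m → Obj Σ (m + k) → Obj Σ k
  lamsO []      b = b
  lamsO (Δ ▷ A) b = lamsO Δ (lam A b)

  tlamsT : ∀ {k m} → Tel Σ k m → Ty Σ (m + k) → Ty Σ k
  tlamsT []      b = b
  tlamsT (Δ ▷ A) b = tlamsT Δ (tlam A b)

  pisT : ∀ {k m} → Tel Σ k m → Ty Σ (m + k) → Ty Σ k
  pisT []      b = b
  pisT (Δ ▷ A) b = pisT Δ (Pi A b)

  pisK : ∀ {k m} → Tel Σ k m → Kd Σ (m + k) → Kd Σ k
  pisK []      b = b
  pisK (Δ ▷ A) b = pisK Δ (KPi A b)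

  appsO : ∀ {k m} → Obj Σ k → (Fin m → Obj Σ k) → Obj Σ k
  appsO {m = zero}  t us = t
  appsO {m = suc m} t us = appsO (app t (us zero)) (us ∘ suc)

  tappsT : ∀ {k m} → Ty Σ k → (Fin m → Obj Σ k) → Ty Σ k
  tappsT {m = zero}  t us = t
  tappsT {m = suc m} t us = tappsT (tapp t (us zero)) (us ∘ suc)

-- Logical relations on μ_1,…,μ_n  (μ_{j+1} is written μ j, j : Fin n)

module LR {v : Variant} {S T : Theory} {n : ℕ} (μ : Fin n → Morphism v S T)
          (lc : Fin (nc (sig S)) → Obj (sig T) 0)
          (la : Fin (na (sig S)) → Ty (sig T) 0) where

  ΣS = sig S
  ΣT = sig T

  μO : ∀ {k k'} → Fin n → Ren k k' → Obj ΣS k → Obj ΣT k'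
  μO j = Hom.mO (mc (μ j)) (ma (μ j))

  μT : ∀ {k k'} → Fin n → Ren k k' → Ty ΣS k → Ty ΣT k'
  μT j = Hom.mT (mc (μ j)) (ma (μ j))

  -- where each source variable x goes: x* (star) and x_j (comp j)
  record LRen (k k' : ℕ) : Set where
    field
      star : Fin k → Fin k'
      comp : Fin n → Fin k → Fin k'
  open LRen public

  -- x_{j+1} in the scope extended by the binders x_1,…,x_n
  xvar : ∀ {k'} → Fin n → Fin (n + k')
  xvar {k'} j = opposite j ↑ˡ k'

  xs : ∀ {k'} → Fin n → Obj ΣT (n + k')
  xs j = var (xvar j)

  wkLR : ∀ {k k'} → LRen k k' → LRen k (n + k')
  wkLR ρ = record { star = (n ↑ʳ_) ∘ star ρ ; comp = λ j → (n ↑ʳ_) ∘ comp ρ j }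

  -- going under a binder x: new binders x_1,…,x_n, x*
  liftLR : ∀ {k k'} → LRen k k' → LRen (suc k) (suc (n + k'))
  liftLR ρ = record
    { star = λ { zero → zero ; (suc i) → suc ((n ↑ʳ (star ρ i))) }
    ; comp = λ j → λ { zero → suc (xvar j) ; (suc i) → suc ((n ↑ʳ (comp ρ j i))) } }

  telμ : ∀ {k k'} → LRen k k' → Ty ΣS k → Tel ΣT k' n
  telμ ρ A = mkTel n (λ j σ → μT j (σ ∘ comp ρ j) A)

  lO : ∀ {k k'} → LRen k k' → Obj ΣS k → Obj ΣT k'
  lT : ∀ {k k'} → LRen k k' → Ty ΣS k → Ty ΣT k'

  lO ρ (var i)   = var (star ρ i)
  lO ρ (con c)   = wk0O (lc c)
  lO ρ (lam A M) =
    lamsO (telμ ρ A) (lam (tappsT (lT (wkLR ρ) A) xs) (lO (liftLR ρ) M))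
  lO ρ (app M N) = app (appsO (lO ρ M) (λ j → μO j (comp ρ j) N)) (lO ρ N)

  lT ρ (tcon a)   = wk0T (la a)
  lT ρ (Pi A B)   =
    tlamsT (telμ ρ (Pi A B))
      (pisT (telμ (wkLR ρ) A)
        (Pi (tappsT (lT (wkLR (wkLR ρ)) A) xs)
            (tappsT (lT (liftLR (wkLR ρ)) B)
                    (λ j → app (var (suc ((n ↑ʳ (xvar j))))) (var (suc (xvar j)))))))
  lT ρ (tlam A B) =
    tlamsT (telμ ρ A) (tlam (tappsT (lT (wkLR ρ) A) xs) (lT (liftLR ρ) B))
  lT ρ (tapp A M) = tapp (tappsT (lT ρ A) (λ j → μO j (comp ρ j) M)) (lO ρ M)

  lK : ∀ {k k'} → LRen k k' → Ty ΣS k → Kd ΣS k → Kd ΣT k'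
  lK ρ R Type      = pisK (telμ ρ R) Type
  lK ρ R (KPi A K) =
    pisK (telμ ρ A)
      (KPi (tappsT (lT (wkLR ρ) A) xs) (lK (liftLR ρ) (tapp (renT suc R) (var zero)) K))

  -- canonical layout of the translated scope: each x becomes x_1,…,x_n,x*
  L : ℕ → ℕ
  L zero    = zero
  L (suc k) = suc (n + L k)

  canon : (k : ℕ) → LRen k (L k)
  canon zero    = record { star = λ () ; comp = λ _ () }
  canon (suc k) = liftLR (canon k)

  λO : ∀ {k} → Obj ΣS k → Obj ΣT (L k)
  λO {k} = lO (canon k)

  λT : ∀ {k} → Ty ΣS k → Ty ΣT (L k)
  λT {k} = lT (canon k)

  λK : ∀ {k} → Ty ΣS k → Kd ΣS k → Kd ΣT (L k)
  λK {k} = lK (canon k)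

  LRRule : Rule ΣS → Set
  LRRule (orule m l r) = Conv._≡O_ v T (λO l) (λO r)
  LRRule (trule m l r) = Conv._≡T_ v T (λT l) (λT r)

  record IsLogicalRelation : Set where
    field
      lc-typed : ∀ c → Typing._⊢_∶_ v T ε (lc c)
                         (tappsT (λT (ctype S c)) (λ j → μO j id (con c)))
      la-typed : ∀ a → Typing._⊢_∶K_ v T ε (la a) (λK (tcon a) (akind S a))
      rules-ok : ∀ {ρ} → ρ ∈ rules S → LRRule ρ

{-# OPTIONS --safe #-}
module Submission where

-- λ is generalised to environments σ, which may send the companions x*, x₁,…,xₙ of a source
-- variable x to arbitrary target terms.  This generalised translation commutes with renaming
-- and substitution on either side; in particular λ(M[x←N]) = λ(M)[λ(x←N)].  Every one-step
-- reduction of S is then simulated by a conversion of T: a β-redex (λx:A.M) N becomes an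
-- (n+1)-fold β-redex reducing to λ(M)[λ(x←N)], an η-expansion becomes an (n+1)-fold
-- η-expansion, and a rule instance ℓθ ↪ rθ becomes λ(ℓ)[λ(θ)] ≡ λ(r)[λ(θ)] because λ is a
-- logical relation.  The remaining steps are congruences, where the μⱼ preserve conversion by
-- the same argument.  Conversion is the equivalence closure of these steps, so it is
-- preserved; for kinds, λ^R only translates the types occurring in them.

open import Defs
open import Data.Nat using (ℕ; zero; suc; _+_)
open import Data.Fin using (Fin; zero; suc; _↑ʳ_; _↑ˡ_; inject₁; fromℕ; opposite; splitAt)
open import Data.Fin.Properties using (splitAt-↑ˡ; splitAt-↑ʳ; opposite-involutive)
open import Data.Sum using ([_,_]′)
open import Data.Product using (_×_; _,_)
open import Data.List.Membership.Propositional using (_∈_)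
open import Function using (_∘_; id)
open import Relation.Binary.PropositionalEquality
open import Relation.Binary.Construct.Closure.Equivalence
  using (gmap; gfold; return; symmetric) 
  renaming (setoid to EqClosure-setoid; isEquivalence to EqClosure-isEquivalence)
import Relation.Binary.Reasoning.Setoid as SetoidReasoning
open import Relation.Binary.Construct.Closure.ReflexiveTransitive using (_◅◅_) renaming (ε to ◅-refl)

opposite-inject₁ : ∀ {m} (j : Fin m) → opposite (inject₁ j) ≡ suc (opposite j)
opposite-inject₁ {suc m} zero    = refl
opposite-inject₁ {suc m} (suc j) = cong inject₁ (opposite-inject₁ j)

opposite-fromℕ : ∀ m → opposite (fromℕ m) ≡ zero
opposite-fromℕ zero    = refl
opposite-fromℕ (suc m) = cong inject₁ (opposite-fromℕ m)

module _ {Σ : Sig} where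
  private variable k k' k'' : ℕ

  ext-id : {ρ : Ren k k} → (∀ i → ρ i ≡ i) → ∀ i → ext ρ i ≡ i
  ext-id h zero    = refl
  ext-id h (suc i) = cong suc (h i)

  ext-∘ : {ρ : Ren k k'} {ρ' : Ren k' k''} {ρ'' : Ren k k''} →
          (∀ i → ρ' (ρ i) ≡ ρ'' i) → ∀ i → ext ρ' (ext ρ i) ≡ ext ρ'' i
  ext-∘ h zero    = refl
  ext-∘ h (suc i) = cong suc (h i)

  renO-id : {ρ : Ren k k} → (∀ i → ρ i ≡ i) → (M : Obj Σ k) → renO ρ M ≡ M
  renT-id : {ρ : Ren k k} → (∀ i → ρ i ≡ i) → (A : Ty Σ k) → renT ρ A ≡ A
  renO-id h (var i)   = cong var (h i)
  renO-id h (con c)   = refl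
  renO-id h (lam A M) = cong₂ lam (renT-id h A) (renO-id (ext-id h) M)
  renO-id h (app M N) = cong₂ app (renO-id h M) (renO-id h N)
  renT-id h (tcon a)   = refl
  renT-id h (Pi A B)   = cong₂ Pi (renT-id h A) (renT-id (ext-id h) B)
  renT-id h (tlam A B) = cong₂ tlam (renT-id h A) (renT-id (ext-id h) B)
  renT-id h (tapp A M) = cong₂ tapp (renT-id h A) (renO-id h M)

  renO-renO : {ρ : Ren k k'} {ρ' : Ren k' k''} {ρ'' : Ren k k''} → (∀ i → ρ' (ρ i) ≡ ρ'' i) →
              (M : Obj Σ k) → renO ρ' (renO ρ M) ≡ renO ρ'' M
  renT-renT : {ρ : Ren k k'} {ρ' : Ren k' k''} {ρ'' : Ren k k''} → (∀ i → ρ' (ρ i) ≡ ρ'' i) →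
              (A : Ty Σ k) → renT ρ' (renT ρ A) ≡ renT ρ'' A
  renO-renO h (var i)   = cong var (h i)
  renO-renO h (con c)   = refl
  renO-renO h (lam A M) = cong₂ lam (renT-renT h A) (renO-renO (ext-∘ h) M)
  renO-renO h (app M N) = cong₂ app (renO-renO h M) (renO-renO h N)
  renT-renT h (tcon a)   = refl
  renT-renT h (Pi A B)   = cong₂ Pi (renT-renT h A) (renT-renT (ext-∘ h) B)
  renT-renT h (tlam A B) = cong₂ tlam (renT-renT h A) (renT-renT (ext-∘ h) B)
  renT-renT h (tapp A M) = cong₂ tapp (renT-renT h A) (renO-renO h M)

  exts-ext : {ρ : Ren k k'} {σ : Sub k' k''} {σ' : Sub {Σ} k k''} →
             (∀ i → σ (ρ i) ≡ σ' i) → ∀ i → exts σ (ext ρ i) ≡ exts σ' i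
  exts-ext h zero    = refl
  exts-ext h (suc i) = cong (renO suc) (h i)

  subO-renO : {ρ : Ren k k'} {σ : Sub k' k''} {σ' : Sub {Σ} k k''} → (∀ i → σ (ρ i) ≡ σ' i) →
              (M : Obj Σ k) → subO σ (renO ρ M) ≡ subO σ' M
  subT-renT : {ρ : Ren k k'} {σ : Sub k' k''} {σ' : Sub {Σ} k k''} → (∀ i → σ (ρ i) ≡ σ' i) →
              (A : Ty Σ k) → subT σ (renT ρ A) ≡ subT σ' A
  subO-renO h (var i)   = h i
  subO-renO h (con c)   = refl
  subO-renO h (lam A M) = cong₂ lam (subT-renT h A) (subO-renO (exts-ext h) M)
  subO-renO h (app M N) = cong₂ app (subO-renO h M) (subO-renO h N)
  subT-renT h (tcon a)   = refl
  subT-renT h (Pi A B)   = cong₂ Pi (subT-renT h A) (subT-renT (exts-ext h) B)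
  subT-renT h (tlam A B) = cong₂ tlam (subT-renT h A) (subT-renT (exts-ext h) B)
  subT-renT h (tapp A M) = cong₂ tapp (subT-renT h A) (subO-renO h M)

  ext-exts : {σ : Sub {Σ} k k'} {ρ : Ren k' k''} {σ' : Sub {Σ} k k''} →
             (∀ i → renO ρ (σ i) ≡ σ' i) → ∀ i → renO (ext ρ) (exts σ i) ≡ exts σ' i
  ext-exts h zero = refl
  ext-exts {σ = σ} h (suc i) =
    trans (renO-renO (λ _ → refl) (σ i)) (trans (sym (renO-renO (λ _ → refl) (σ i))) (cong (renO suc) (h i)))

  renO-subO : {σ : Sub {Σ} k k'} {ρ : Ren k' k''} {σ' : Sub {Σ} k k''} → (∀ i → renO ρ (σ i) ≡ σ' i) →
              (M : Obj Σ k) → renO ρ (subO σ M) ≡ subO σ' M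
  renT-subT : {σ : Sub {Σ} k k'} {ρ : Ren k' k''} {σ' : Sub {Σ} k k''} → (∀ i → renO ρ (σ i) ≡ σ' i) →
              (A : Ty Σ k) → renT ρ (subT σ A) ≡ subT σ' A
  renO-subO h (var i)   = h i
  renO-subO h (con c)   = refl
  renO-subO h (lam A M) = cong₂ lam (renT-subT h A) (renO-subO (ext-exts h) M)
  renO-subO h (app M N) = cong₂ app (renO-subO h M) (renO-subO h N)
  renT-subT h (tcon a)   = refl
  renT-subT h (Pi A B)   = cong₂ Pi (renT-subT h A) (renT-subT (ext-exts h) B)
  renT-subT h (tlam A B) = cong₂ tlam (renT-subT h A) (renT-subT (ext-exts h) B)
  renT-subT h (tapp A M) = cong₂ tapp (renT-subT h A) (renO-subO h M)

  exts-var : {σ : Sub {Σ} k k'} {ρ : Ren k k'} → (∀ i → σ i ≡ var (ρ i)) → ∀ i → exts σ i ≡ var (ext ρ i)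
  exts-var h zero    = refl
  exts-var h (suc i) = cong (renO suc) (h i)

  subO-var : {σ : Sub {Σ} k k'} {ρ : Ren k k'} → (∀ i → σ i ≡ var (ρ i)) → (M : Obj Σ k) → subO σ M ≡ renO ρ M
  subT-var : {σ : Sub {Σ} k k'} {ρ : Ren k k'} → (∀ i → σ i ≡ var (ρ i)) → (A : Ty Σ k) → subT σ A ≡ renT ρ A
  subO-var h (var i)   = h i
  subO-var h (con c)   = refl
  subO-var h (lam A M) = cong₂ lam (subT-var h A) (subO-var (exts-var h) M)
  subO-var h (app M N) = cong₂ app (subO-var h M) (subO-var h N)
  subT-var h (tcon a)   = refl
  subT-var h (Pi A B)   = cong₂ Pi (subT-var h A) (subT-var (exts-var h) B)
  subT-var h (tlam A B) = cong₂ tlam (subT-var h A) (subT-var (exts-var h) B)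
  subT-var h (tapp A M) = cong₂ tapp (subT-var h A) (subO-var h M)

  subO-id : {σ : Sub {Σ} k k} → (∀ i → σ i ≡ var i) → (M : Obj Σ k) → subO σ M ≡ M
  subO-id h M = trans (subO-var {ρ = id} h M) (renO-id (λ _ → refl) M)

  subT-id : {σ : Sub {Σ} k k} → (∀ i → σ i ≡ var i) → (A : Ty Σ k) → subT σ A ≡ A
  subT-id h A = trans (subT-var {ρ = id} h A) (renT-id (λ _ → refl) A)

  exts-exts : {σ : Sub {Σ} k k'} {τ : Sub k' k''} {σ' : Sub {Σ} k k''} →
              (∀ i → subO τ (σ i) ≡ σ' i) → ∀ i → subO (exts τ) (exts σ i) ≡ exts σ' i
  exts-exts h zero = refl
  exts-exts {σ = σ} h (suc i) =
    trans (subO-renO (λ _ → refl) (σ i)) (trans (sym (renO-subO (λ _ → refl) (σ i))) (cong (renO suc) (h i)))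

  subO-subO : {σ : Sub {Σ} k k'} {τ : Sub k' k''} {σ' : Sub {Σ} k k''} → (∀ i → subO τ (σ i) ≡ σ' i) →
              (M : Obj Σ k) → subO τ (subO σ M) ≡ subO σ' M
  subT-subT : {σ : Sub {Σ} k k'} {τ : Sub k' k''} {σ' : Sub {Σ} k k''} → (∀ i → subO τ (σ i) ≡ σ' i) →
              (A : Ty Σ k) → subT τ (subT σ A) ≡ subT σ' A
  subO-subO h (var i)   = h i
  subO-subO h (con c)   = refl
  subO-subO h (lam A M) = cong₂ lam (subT-subT h A) (subO-subO (exts-exts h) M)
  subO-subO h (app M N) = cong₂ app (subO-subO h M) (subO-subO h N)
  subT-subT h (tcon a)   = refl
  subT-subT h (Pi A B)   = cong₂ Pi (subT-subT h A) (subT-subT (exts-exts h) B)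
  subT-subT h (tlam A B) = cong₂ tlam (subT-subT h A) (subT-subT (exts-exts h) B)
  subT-subT h (tapp A M) = cong₂ tapp (subT-subT h A) (subO-subO h M)

  subO-wk0O : (σ : Sub {Σ} k k') (M : Obj Σ 0) → subO σ (wk0O M) ≡ wk0O M
  subO-wk0O σ M = trans (subO-renO {σ' = λ ()} (λ ()) M) (subO-var (λ ()) M)

  subT-wk0T : (σ : Sub {Σ} k k') (A : Ty Σ 0) → subT σ (wk0T A) ≡ wk0T A
  subT-wk0T σ A = trans (subT-renT {σ' = λ ()} (λ ()) A) (subT-var (λ ()) A)

  sg-renO : (N M : Obj Σ k) → subO (sg N) (renO suc M) ≡ M
  sg-renO N M = trans (subO-renO (λ _ → refl) M) (subO-id (λ _ → refl) M)

  exts-sg : (σ : Sub {Σ} k k') (N : Obj Σ k) → ∀ i → subO (sg (subO σ N)) (exts σ i) ≡ subO σ (sg N i)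
  exts-sg σ N zero    = refl
  exts-sg σ N (suc i) = sg-renO _ (σ i)

  extsⁿ : ∀ m → Sub {Σ} k k' → Sub {Σ} (m + k) (m + k')
  extsⁿ zero    σ = σ
  extsⁿ (suc m) σ = exts (extsⁿ m σ)

  extsⁿ-↑ʳ : ∀ m (σ : Sub {Σ} k k') i → extsⁿ m σ (m ↑ʳ i) ≡ renO (m ↑ʳ_) (σ i)
  extsⁿ-↑ʳ zero    σ i = sym (renO-id (λ _ → refl) (σ i))
  extsⁿ-↑ʳ (suc m) σ i = trans (cong (renO suc) (extsⁿ-↑ʳ m σ i)) (renO-renO (λ _ → refl) (σ i))

  extsⁿ-↑ˡ : ∀ m (σ : Sub {Σ} k k') (i : Fin m) → extsⁿ m σ (i ↑ˡ k) ≡ var (i ↑ˡ k')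
  extsⁿ-↑ˡ (suc m) σ zero    = refl
  extsⁿ-↑ˡ (suc m) σ (suc i) = cong (renO suc) (extsⁿ-↑ˡ m σ i)

  subO-renO-↑ʳ : ∀ m (σ : Sub {Σ} k k') M → subO (extsⁿ m σ) (renO (m ↑ʳ_) M) ≡ renO (m ↑ʳ_) (subO σ M)
  subO-renO-↑ʳ m σ M =
    trans (subO-renO (extsⁿ-↑ʳ m σ) M) (sym (renO-subO {σ' = renO (m ↑ʳ_) ∘ σ} (λ _ → refl) M))

module _ {Σ : Sig} where
  private variable k k' m : ℕ

  subTel : Sub {Σ} k k' → Tel Σ k m → Tel Σ k' m
  subTel σ []            = []
  subTel σ (_▷_ {m} Δ A) = subTel σ Δ ▷ subT (extsⁿ m σ) A

  mkTel-cong : ∀ m {f g : (j : Fin m) → ∀ {k''} → Ren k k'' → Ty Σ k''} →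
               (∀ j {k''} (r : Ren k k'') → f j r ≡ g j r) → mkTel m f ≡ mkTel m g
  mkTel-cong zero    h = refl
  mkTel-cong (suc m) h = cong₂ _▷_ (mkTel-cong m (λ j → h (inject₁ j))) (h (fromℕ m) (m ↑ʳ_))

  subTel-mkTel : ∀ m {f : (j : Fin m) → ∀ {k''} → Ren k k'' → Ty Σ k''}
                 {g : (j : Fin m) → ∀ {k''} → Ren k' k'' → Ty Σ k''} (σ : Sub {Σ} k k') →
                 (∀ j p → subT (extsⁿ p σ) (f j (p ↑ʳ_)) ≡ g j (p ↑ʳ_)) → subTel σ (mkTel m f) ≡ mkTel m g
  subTel-mkTel zero    σ h = refl
  subTel-mkTel (suc m) σ h = cong₂ _▷_ (subTel-mkTel m σ (λ j → h (inject₁ j))) (h (fromℕ m) m)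

  lamsO-subO : (σ : Sub {Σ} k k') (Δ : Tel Σ k m) (b : Obj Σ (m + k)) →
               subO σ (lamsO Δ b) ≡ lamsO (subTel σ Δ) (subO (extsⁿ m σ) b)
  lamsO-subO σ []      b = refl
  lamsO-subO σ (Δ ▷ A) b = lamsO-subO σ Δ (lam A b)

  tlamsT-subT : (σ : Sub {Σ} k k') (Δ : Tel Σ k m) (b : Ty Σ (m + k)) →
                subT σ (tlamsT Δ b) ≡ tlamsT (subTel σ Δ) (subT (extsⁿ m σ) b)
  tlamsT-subT σ []      b = refl
  tlamsT-subT σ (Δ ▷ A) b = tlamsT-subT σ Δ (tlam A b)

  pisT-subT : (σ : Sub {Σ} k k') (Δ : Tel Σ k m) (b : Ty Σ (m + k)) →
              subT σ (pisT Δ b) ≡ pisT (subTel σ Δ) (subT (extsⁿ m σ) b)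
  pisT-subT σ []      b = refl
  pisT-subT σ (Δ ▷ A) b = pisT-subT σ Δ (Pi A b)

  appsO-cong : {t t' : Obj Σ k} {us us' : Fin m → Obj Σ k} →
               t ≡ t' → (∀ j → us j ≡ us' j) → appsO t us ≡ appsO t' us'
  appsO-cong {m = zero}  refl h = refl
  appsO-cong {m = suc m} refl h = appsO-cong (cong (app _) (h zero)) (h ∘ suc)

  tappsT-cong : {t t' : Ty Σ k} {us us' : Fin m → Obj Σ k} →
                t ≡ t' → (∀ j → us j ≡ us' j) → tappsT t us ≡ tappsT t' us'
  tappsT-cong {m = zero}  refl h = refl
  tappsT-cong {m = suc m} refl h = tappsT-cong (cong (tapp _) (h zero)) (h ∘ suc)

  appsO-subO : (σ : Sub {Σ} k k') (t : Obj Σ k) (us : Fin m → Obj Σ k) →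
               subO σ (appsO t us) ≡ appsO (subO σ t) (subO σ ∘ us)
  appsO-subO {m = zero}  σ t us = refl
  appsO-subO {m = suc m} σ t us = appsO-subO σ (app t (us zero)) (us ∘ suc)

  tappsT-subT : (σ : Sub {Σ} k k') (t : Ty Σ k) (us : Fin m → Obj Σ k) →
                subT σ (tappsT t us) ≡ tappsT (subT σ t) (subO σ ∘ us)
  tappsT-subT {m = zero}  σ t us = refl
  tappsT-subT {m = suc m} σ t us = tappsT-subT σ (tapp t (us zero)) (us ∘ suc)

  appsO-renO : (r : Ren k k') (t : Obj Σ k) (us : Fin m → Obj Σ k) →
               renO r (appsO t us) ≡ appsO (renO r t) (renO r ∘ us)
  appsO-renO {m = zero}  r t us = refl
  appsO-renO {m = suc m} r t us = appsO-renO r (app t (us zero)) (us ∘ suc)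

  tappsT-renT : (r : Ren k k') (t : Ty Σ k) (us : Fin m → Obj Σ k) →
                renT r (tappsT t us) ≡ tappsT (renT r t) (renO r ∘ us)
  tappsT-renT {m = zero}  r t us = refl
  tappsT-renT {m = suc m} r t us = tappsT-renT r (tapp t (us zero)) (us ∘ suc)

  appsO-snoc : (t : Obj Σ k) (us : Fin (suc m) → Obj Σ k) →
               appsO t us ≡ app (appsO t (us ∘ inject₁)) (us (fromℕ m))
  appsO-snoc {m = zero}  t us = refl
  appsO-snoc {m = suc m} t us = appsO-snoc (app t (us zero)) (us ∘ suc)

  tappsT-snoc : (t : Ty Σ k) (us : Fin (suc m) → Obj Σ k) →
                tappsT t us ≡ tapp (tappsT t (us ∘ inject₁)) (us (fromℕ m))
  tappsT-snoc {m = zero}  t us = refl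
  tappsT-snoc {m = suc m} t us = tappsT-snoc (tapp t (us zero)) (us ∘ suc)

  -- Binder j of a telescope of length m, counted from the outside, is the variable opposite j;
  -- telSub m us substitutes us j for it.
  telVars : ∀ m → Fin m → Obj Σ (m + k)
  telVars {k} m j = var (opposite j ↑ˡ k)

  telVars-inject₁ : ∀ m (j : Fin m) → renO suc (telVars {k} m j) ≡ telVars (suc m) (inject₁ j)
  telVars-inject₁ {k} m j = cong (λ x → var (x ↑ˡ k)) (sym (opposite-inject₁ j))

  telVars-fromℕ : ∀ m → telVars {k} (suc m) (fromℕ m) ≡ var zero
  telVars-fromℕ {k} m = cong (λ x → var (x ↑ˡ k)) (opposite-fromℕ m)

  tappsT-telVars-subT : ∀ m (σ : Sub {Σ} k k') (t : Ty Σ (m + k)) →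
                        subT (extsⁿ m σ) (tappsT t (telVars m)) ≡ tappsT (subT (extsⁿ m σ) t) (telVars m)
  tappsT-telVars-subT m σ t =
    trans (tappsT-subT (extsⁿ m σ) t (telVars m)) (tappsT-cong refl (λ j → extsⁿ-↑ˡ m σ (opposite j)))

  telSub : ∀ m → (Fin m → Obj Σ k) → Sub {Σ} (m + k) k
  telSub zero    us         = var
  telSub (suc m) us zero    = us (fromℕ m)
  telSub (suc m) us (suc i) = telSub m (us ∘ inject₁) i

  telSub-↑ʳ : ∀ m (us : Fin m → Obj Σ k) i → telSub m us (m ↑ʳ i) ≡ var i
  telSub-↑ʳ zero    us i = refl
  telSub-↑ʳ (suc m) us i = telSub-↑ʳ m (us ∘ inject₁) i

  telSub-↑ˡ : ∀ m (us : Fin m → Obj Σ k) i → telSub m us (i ↑ˡ k) ≡ us (opposite i)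
  telSub-↑ˡ (suc m) us zero    = refl
  telSub-↑ˡ (suc m) us (suc i) = telSub-↑ˡ m (us ∘ inject₁) i

  telSub-suc : ∀ m (us : Fin (suc m) → Obj Σ k) i →
               subO (sg (us (fromℕ m))) (exts (telSub m (us ∘ inject₁)) i) ≡ telSub (suc m) us i
  telSub-suc m us zero    = refl
  telSub-suc m us (suc i) = sg-renO (us (fromℕ m)) (telSub m (us ∘ inject₁) i)

module ConvProperties (v : Variant) (Th : Theory) where
  open Conv v Th
  private
    Σ = sig Th
    variable k k' m : ℕ

  module ≡O-Reasoning {k : ℕ} = SetoidReasoning (EqClosure-setoid (_↪O_ {k}))
  module ≡T-Reasoning {k : ℕ} = SetoidReasoning (EqClosure-setoid (_↪T_ {k}))

  ≡O-reflexive : {M M' : Obj Σ k} → M ≡ M' → M ≡O M'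
  ≡O-reflexive refl = ◅-refl

  ≡T-reflexive : {A A' : Ty Σ k} → A ≡ A' → A ≡T A'
  ≡T-reflexive refl = ◅-refl

  ≡O-sym : {M M' : Obj Σ k} → M ≡O M' → M' ≡O M
  ≡O-sym = symmetric _↪O_

  ≡T-sym : {A A' : Ty Σ k} → A ≡T A' → A' ≡T A
  ≡T-sym = symmetric _↪T_

  lam-≡O : {A A' : Ty Σ k} {M M' : Obj Σ (suc k)} → A ≡T A' → M ≡O M' → lam A M ≡O lam A' M'
  lam-≡O a e = gmap (λ A → lam A _) lamA a ◅◅ gmap (lam _) lamM e

  app-≡O : {M M' N N' : Obj Σ k} → M ≡O M' → N ≡O N' → app M N ≡O app M' N'
  app-≡O a e = gmap (λ M → app M _) appL a ◅◅ gmap (app _) appR e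

  Pi-≡T : {A A' : Ty Σ k} {B B' : Ty Σ (suc k)} → A ≡T A' → B ≡T B' → Pi A B ≡T Pi A' B'
  Pi-≡T a e = gmap (λ A → Pi A _) PiA a ◅◅ gmap (Pi _) PiB e

  tlam-≡T : {A A' : Ty Σ k} {B B' : Ty Σ (suc k)} → A ≡T A' → B ≡T B' → tlam A B ≡T tlam A' B'
  tlam-≡T a e = gmap (λ A → tlam A _) tlamA a ◅◅ gmap (tlam _) tlamB e

  tapp-≡T : {A A' : Ty Σ k} {M M' : Obj Σ k} → A ≡T A' → M ≡O M' → tapp A M ≡T tapp A' M'
  tapp-≡T a e = gmap (λ A → tapp A _) tappL a ◅◅ gmap (tapp _) tappR e

  KPi-≡K : {A A' : Ty Σ k} {K K' : Kd Σ (suc k)} → A ≡T A' → K ≡K K' → KPi A K ≡K KPi A' K'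
  KPi-≡K a e = gmap (λ A → KPi A _) KPiA a ◅◅ gmap (KPi _) KPiK e

  subO-↪O : (σ : Sub {Σ} k k') {M M' : Obj Σ k} → M ↪O M' → subO σ M ↪O subO σ M'
  subT-↪T : (σ : Sub {Σ} k k') {A A' : Ty Σ k} → A ↪T A' → subT σ A ↪T subT σ A'
  subO-↪O σ (β {A = A} {M} {N}) =
    subst (subO σ (app (lam A M) N) ↪O_)
      (trans (subO-subO (exts-sg σ N) M) (sym (subO-subO (λ _ → refl) M))) β
  subO-↪O σ (η A {M} e) =
    subst (λ X → subO σ M ↪O lam (subT σ A) (app X (var zero)))
      (trans (renO-subO (λ _ → refl) M) (sym (subO-renO (λ _ → refl) M))) (η (subT σ A) e)
  subO-↪O σ (rule {l = l} {r} l↪r τ) =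
    subst₂ _↪O_ (sym (subO-subO (λ _ → refl) l)) (sym (subO-subO (λ _ → refl) r)) (rule l↪r (subO σ ∘ τ))
  subO-↪O σ (lamA s) = lamA (subT-↪T σ s)
  subO-↪O σ (lamM s) = lamM (subO-↪O (exts σ) s)
  subO-↪O σ (appL s) = appL (subO-↪O σ s)
  subO-↪O σ (appR s) = appR (subO-↪O σ s)
  subT-↪T σ (β {A = A} {B} {N}) =
    subst (subT σ (tapp (tlam A B) N) ↪T_)
      (trans (subT-subT (exts-sg σ N) B) (sym (subT-subT (λ _ → refl) B))) β
  subT-↪T σ (η A {B} e) =
    subst (λ X → subT σ B ↪T tlam (subT σ A) (tapp X (var zero)))
      (trans (renT-subT (λ _ → refl) B) (sym (subT-renT (λ _ → refl) B))) (η (subT σ A) e)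
  subT-↪T σ (rule {l = l} {r} l↪r τ) =
    subst₂ _↪T_ (sym (subT-subT (λ _ → refl) l)) (sym (subT-subT (λ _ → refl) r)) (rule l↪r (subO σ ∘ τ))
  subT-↪T σ (PiA s)   = PiA (subT-↪T σ s)
  subT-↪T σ (PiB s)   = PiB (subT-↪T (exts σ) s)
  subT-↪T σ (tlamA s) = tlamA (subT-↪T σ s)
  subT-↪T σ (tlamB s) = tlamB (subT-↪T (exts σ) s)
  subT-↪T σ (tappL s) = tappL (subT-↪T σ s)
  subT-↪T σ (tappR s) = tappR (subO-↪O σ s)

  subO-≡O : (σ : Sub {Σ} k k') {M M' : Obj Σ k} → M ≡O M' → subO σ M ≡O subO σ M'
  subO-≡O σ = gmap (subO σ) (subO-↪O σ)

  subT-≡T : (σ : Sub {Σ} k k') {A A' : Ty Σ k} → A ≡T A' → subT σ A ≡T subT σ A'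
  subT-≡T σ = gmap (subT σ) (subT-↪T σ)

  data _≡Tel_ : Tel Σ k m → Tel Σ k m → Set where
    []  : _≡Tel_ {k} [] []
    _▷_ : {Δ Δ' : Tel Σ k m} {A A' : Ty Σ (m + k)} → Δ ≡Tel Δ' → A ≡T A' → (Δ ▷ A) ≡Tel (Δ' ▷ A')

  ≡Tel-refl : (Δ : Tel Σ k m) → Δ ≡Tel Δ
  ≡Tel-refl []      = []
  ≡Tel-refl (Δ ▷ A) = ≡Tel-refl Δ ▷ ◅-refl

  mkTel-≡Tel : ∀ m {f g : (j : Fin m) → ∀ {k''} → Ren k k'' → Ty Σ k''} →
               (∀ j {k''} (r : Ren k k'') → f j r ≡T g j r) → mkTel m f ≡Tel mkTel m g
  mkTel-≡Tel zero    h = []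
  mkTel-≡Tel (suc m) h = mkTel-≡Tel m (λ j → h (inject₁ j)) ▷ h (fromℕ m) (m ↑ʳ_)

  lamsO-≡O : {Δ Δ' : Tel Σ k m} {b b' : Obj Σ (m + k)} → Δ ≡Tel Δ' → b ≡O b' → lamsO Δ b ≡O lamsO Δ' b'
  lamsO-≡O []      e = e
  lamsO-≡O (r ▷ a) e = lamsO-≡O r (lam-≡O a e)

  tlamsT-≡T : {Δ Δ' : Tel Σ k m} {b b' : Ty Σ (m + k)} → Δ ≡Tel Δ' → b ≡T b' → tlamsT Δ b ≡T tlamsT Δ' b'
  tlamsT-≡T []      e = e
  tlamsT-≡T (r ▷ a) e = tlamsT-≡T r (tlam-≡T a e)

  pisT-≡T : {Δ Δ' : Tel Σ k m} {b b' : Ty Σ (m + k)} → Δ ≡Tel Δ' → b ≡T b' → pisT Δ b ≡T pisT Δ' b'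
  pisT-≡T []      e = e
  pisT-≡T (r ▷ a) e = pisT-≡T r (Pi-≡T a e)

  pisK-≡K : {Δ Δ' : Tel Σ k m} {b b' : Kd Σ (m + k)} → Δ ≡Tel Δ' → b ≡K b' → pisK Δ b ≡K pisK Δ' b'
  pisK-≡K []      e = e
  pisK-≡K (r ▷ a) e = pisK-≡K r (KPi-≡K a e)

  appsO-≡O : {t t' : Obj Σ k} {us us' : Fin m → Obj Σ k} →
             t ≡O t' → (∀ j → us j ≡O us' j) → appsO t us ≡O appsO t' us'
  appsO-≡O {m = zero}  e h = e
  appsO-≡O {m = suc m} e h = appsO-≡O (app-≡O e (h zero)) (h ∘ suc)

  tappsT-≡T : {t t' : Ty Σ k} {us us' : Fin m → Obj Σ k} →
              t ≡T t' → (∀ j → us j ≡O us' j) → tappsT t us ≡T tappsT t' us'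
  tappsT-≡T {m = zero}  e h = e
  tappsT-≡T {m = suc m} e h = tappsT-≡T (tapp-≡T e (h zero)) (h ∘ suc)

  appsO-lamsO-β : (Δ : Tel Σ k m) (b : Obj Σ (m + k)) (us : Fin m → Obj Σ k) →
                  appsO (lamsO Δ b) us ≡O subO (telSub m us) b
  appsO-lamsO-β []            b us = ≡O-reflexive (sym (subO-id (λ _ → refl) b))
  appsO-lamsO-β (_▷_ {m} Δ A) b us =
    ≡O-reflexive (appsO-snoc _ us)
    ◅◅ app-≡O (appsO-lamsO-β Δ (lam A b) (us ∘ inject₁)) ◅-refl
    ◅◅ return β
    ◅◅ ≡O-reflexive (subO-subO (telSub-suc m us) b)

  tappsT-tlamsT-β : (Δ : Tel Σ k m) (b : Ty Σ (m + k)) (us : Fin m → Obj Σ k) →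
                    tappsT (tlamsT Δ b) us ≡T subT (telSub m us) b
  tappsT-tlamsT-β []            b us = ≡T-reflexive (sym (subT-id (λ _ → refl) b))
  tappsT-tlamsT-β (_▷_ {m} Δ A) b us =
    ≡T-reflexive (tappsT-snoc _ us)
    ◅◅ tapp-≡T (tappsT-tlamsT-β Δ (tlam A b) (us ∘ inject₁)) ◅-refl
    ◅◅ return β
    ◅◅ ≡T-reflexive (subT-subT (telSub-suc m us) b)

  appsO-telVars-snoc : (t : Obj Σ (suc m + k)) →
                       appsO t (telVars (suc m)) ≡ app (appsO t (renO suc ∘ telVars m)) (var zero)
  appsO-telVars-snoc {m = m} t =
    trans (appsO-snoc t (telVars (suc m)))
          (cong₂ app (appsO-cong refl (λ j → sym (telVars-inject₁ m j))) (telVars-fromℕ m))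

  tappsT-telVars-snoc : (t : Ty Σ (suc m + k)) →
                        tappsT t (telVars (suc m)) ≡ tapp (tappsT t (renO suc ∘ telVars m)) (var zero)
  tappsT-telVars-snoc {m = m} t =
    trans (tappsT-snoc t (telVars (suc m)))
          (cong₂ tapp (tappsT-cong refl (λ j → sym (telVars-inject₁ m j))) (telVars-fromℕ m))

  η-appsO-telVars : (t : Obj Σ k) →
    app (renO suc (appsO (renO (m ↑ʳ_) t) (telVars m))) (var zero) ≡ appsO (renO (suc m ↑ʳ_) t) (telVars (suc m))
  η-appsO-telVars {m = m} t = begin
    app (renO suc (appsO (renO (m ↑ʳ_) t) (telVars m))) (var zero)
      ≡⟨ cong (λ X → app X (var zero)) (appsO-renO suc (renO (m ↑ʳ_) t) (telVars m)) ⟩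
    app (appsO (renO suc (renO (m ↑ʳ_) t)) (renO suc ∘ telVars m)) (var zero)
      ≡⟨ cong (λ X → app (appsO X (renO suc ∘ telVars m)) (var zero)) (renO-renO (λ _ → refl) t) ⟩
    app (appsO (renO (suc m ↑ʳ_) t) (renO suc ∘ telVars m)) (var zero)
      ≡⟨ appsO-telVars-snoc {m = m} (renO (suc m ↑ʳ_) t) ⟨
    appsO (renO (suc m ↑ʳ_) t) (telVars (suc m)) ∎
    where open ≡-Reasoning

  η-tappsT-telVars : (t : Ty Σ k) →
    tapp (renT suc (tappsT (renT (m ↑ʳ_) t) (telVars m))) (var zero) ≡ tappsT (renT (suc m ↑ʳ_) t) (telVars (suc m))
  η-tappsT-telVars {m = m} t = begin
    tapp (renT suc (tappsT (renT (m ↑ʳ_) t) (telVars m))) (var zero)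
      ≡⟨ cong (λ X → tapp X (var zero)) (tappsT-renT suc (renT (m ↑ʳ_) t) (telVars m)) ⟩
    tapp (tappsT (renT suc (renT (m ↑ʳ_) t)) (renO suc ∘ telVars m)) (var zero)
      ≡⟨ cong (λ X → tapp (tappsT X (renO suc ∘ telVars m)) (var zero)) (renT-renT (λ _ → refl) t) ⟩
    tapp (tappsT (renT (suc m ↑ʳ_) t) (renO suc ∘ telVars m)) (var zero)
      ≡⟨ tappsT-telVars-snoc {m = m} (renT (suc m ↑ʳ_) t) ⟨
    tappsT (renT (suc m ↑ʳ_) t) (telVars (suc m)) ∎
    where open ≡-Reasoning

  lamsO-η : v ≡ βηR → (Δ : Tel Σ k m) (t : Obj Σ k) → t ≡O lamsO Δ (appsO (renO (m ↑ʳ_) t) (telVars m))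
  lamsO-η e []      t = ≡O-reflexive (sym (renO-id (λ _ → refl) t))
  lamsO-η e (Δ ▷ A) t =
    lamsO-η e Δ t ◅◅ lamsO-≡O (≡Tel-refl Δ) (return (η A e) ◅◅ ≡O-reflexive (cong (lam A) (η-appsO-telVars t)))

  tlamsT-η : v ≡ βηR → (Δ : Tel Σ k m) (t : Ty Σ k) → t ≡T tlamsT Δ (tappsT (renT (m ↑ʳ_) t) (telVars m))
  tlamsT-η e []      t = ≡T-reflexive (sym (renT-id (λ _ → refl) t))
  tlamsT-η e (Δ ▷ A) t =
    tlamsT-η e Δ t ◅◅ tlamsT-≡T (≡Tel-refl Δ) (return (η A e) ◅◅ ≡T-reflexive (cong (tlam A) (η-tappsT-telVars t)))

  lamsO-lam-η : v ≡ βηR → (Δ : Tel Σ k m) (A : Ty Σ (m + k)) (t : Obj Σ k) →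
    t ≡O lamsO Δ (lam A (app (appsO (renO (suc m ↑ʳ_) t) (renO suc ∘ telVars m)) (var zero)))
  lamsO-lam-η {m = m} e Δ A t =
    lamsO-η e (Δ ▷ A) t ◅◅ ≡O-reflexive (cong (lamsO Δ ∘ lam A) (appsO-telVars-snoc {m = m} _))

  tlamsT-tlam-η : v ≡ βηR → (Δ : Tel Σ k m) (A : Ty Σ (m + k)) (t : Ty Σ k) →
    t ≡T tlamsT Δ (tlam A (tapp (tappsT (renT (suc m ↑ʳ_) t) (renO suc ∘ telVars m)) (var zero)))
  tlamsT-tlam-η {m = m} e Δ A t =
    tlamsT-η e (Δ ▷ A) t ◅◅ ≡T-reflexive (cong (tlamsT Δ ∘ tlam A) (tappsT-telVars-snoc {m = m} _))

module HomProperties {Σ Σ' : Sig} (mc : Fin (nc Σ) → Obj Σ' 0) (ma : Fin (na Σ) → Ty Σ' 0) where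
  open Hom mc ma
  private variable k k' k'' : ℕ

  homO : (Fin k → Obj Σ' k') → Obj Σ k → Obj Σ' k'
  homT : (Fin k → Obj Σ' k') → Ty Σ k → Ty Σ' k'
  homO τ (var i)   = τ i
  homO τ (con c)   = wk0O (mc c)
  homO τ (lam A M) = lam (homT τ A) (homO (exts τ) M)
  homO τ (app M N) = app (homO τ M) (homO τ N)
  homT τ (tcon a)   = wk0T (ma a)
  homT τ (Pi A B)   = Pi (homT τ A) (homT (exts τ) B)
  homT τ (tlam A B) = tlam (homT τ A) (homT (exts τ) B)
  homT τ (tapp A M) = tapp (homT τ A) (homO τ M)

  ext-exts-var : {ρ : Ren k k'} {τ : Fin k → Obj Σ' k'} → (∀ i → var (ρ i) ≡ τ i) →
                 ∀ i → var (ext ρ i) ≡ exts τ i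
  ext-exts-var h zero    = refl
  ext-exts-var h (suc i) = cong (renO suc) (h i)

  mO-homO : {ρ : Ren k k'} {τ : Fin k → Obj Σ' k'} → (∀ i → var (ρ i) ≡ τ i) →
            (M : Obj Σ k) → mO ρ M ≡ homO τ M
  mT-homT : {ρ : Ren k k'} {τ : Fin k → Obj Σ' k'} → (∀ i → var (ρ i) ≡ τ i) →
            (A : Ty Σ k) → mT ρ A ≡ homT τ A
  mO-homO h (var i)   = h i
  mO-homO h (con c)   = refl
  mO-homO h (lam A M) = cong₂ lam (mT-homT h A) (mO-homO (ext-exts-var h) M)
  mO-homO h (app M N) = cong₂ app (mO-homO h M) (mO-homO h N)
  mT-homT h (tcon a)   = refl
  mT-homT h (Pi A B)   = cong₂ Pi (mT-homT h A) (mT-homT (ext-exts-var h) B)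
  mT-homT h (tlam A B) = cong₂ tlam (mT-homT h A) (mT-homT (ext-exts-var h) B)
  mT-homT h (tapp A M) = cong₂ tapp (mT-homT h A) (mO-homO h M)

  homO-renO : {r : Ren k k'} {τ : Fin k' → Obj Σ' k''} {τ' : Fin k → Obj Σ' k''} →
              (∀ i → τ (r i) ≡ τ' i) → (M : Obj Σ k) → homO τ (renO r M) ≡ homO τ' M
  homT-renT : {r : Ren k k'} {τ : Fin k' → Obj Σ' k''} {τ' : Fin k → Obj Σ' k''} →
              (∀ i → τ (r i) ≡ τ' i) → (A : Ty Σ k) → homT τ (renT r A) ≡ homT τ' A
  homO-renO h (var i)   = h i
  homO-renO h (con c)   = refl
  homO-renO h (lam A M) = cong₂ lam (homT-renT h A) (homO-renO (exts-ext h) M)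
  homO-renO h (app M N) = cong₂ app (homO-renO h M) (homO-renO h N)
  homT-renT h (tcon a)   = refl
  homT-renT h (Pi A B)   = cong₂ Pi (homT-renT h A) (homT-renT (exts-ext h) B)
  homT-renT h (tlam A B) = cong₂ tlam (homT-renT h A) (homT-renT (exts-ext h) B)
  homT-renT h (tapp A M) = cong₂ tapp (homT-renT h A) (homO-renO h M)

  subO-homO : {τ : Fin k → Obj Σ' k'} {σ : Sub {Σ'} k' k''} {τ' : Fin k → Obj Σ' k''} →
              (∀ i → subO σ (τ i) ≡ τ' i) → (M : Obj Σ k) → subO σ (homO τ M) ≡ homO τ' M
  subT-homT : {τ : Fin k → Obj Σ' k'} {σ : Sub {Σ'} k' k''} {τ' : Fin k → Obj Σ' k''} →
              (∀ i → subO σ (τ i) ≡ τ' i) → (A : Ty Σ k) → subT σ (homT τ A) ≡ homT τ' A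
  subO-homO h (var i)   = h i
  subO-homO h (con c)   = subO-wk0O _ (mc c)
  subO-homO h (lam A M) = cong₂ lam (subT-homT h A) (subO-homO (exts-exts h) M)
  subO-homO h (app M N) = cong₂ app (subO-homO h M) (subO-homO h N)
  subT-homT h (tcon a)   = subT-wk0T _ (ma a)
  subT-homT h (Pi A B)   = cong₂ Pi (subT-homT h A) (subT-homT (exts-exts h) B)
  subT-homT h (tlam A B) = cong₂ tlam (subT-homT h A) (subT-homT (exts-exts h) B)
  subT-homT h (tapp A M) = cong₂ tapp (subT-homT h A) (subO-homO h M)

  renO-homO : {τ : Fin k → Obj Σ' k'} {r : Ren k' k''} {τ' : Fin k → Obj Σ' k''} →
              (∀ i → renO r (τ i) ≡ τ' i) → (M : Obj Σ k) → renO r (homO τ M) ≡ homO τ' M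
  renO-homO {τ = τ} {r} h M =
    trans (sym (subO-var {ρ = r} (λ _ → refl) (homO τ M))) (subO-homO (λ i → trans (subO-var (λ _ → refl) (τ i)) (h i)) M)

  renT-homT : {τ : Fin k → Obj Σ' k'} {r : Ren k' k''} {τ' : Fin k → Obj Σ' k''} →
              (∀ i → renO r (τ i) ≡ τ' i) → (A : Ty Σ k) → renT r (homT τ A) ≡ homT τ' A
  renT-homT {τ = τ} {r} h A =
    trans (sym (subT-var {ρ = r} (λ _ → refl) (homT τ A))) (subT-homT (λ i → trans (subO-var (λ _ → refl) (τ i)) (h i)) A)

  exts-homO : {σ : Sub {Σ} k k'} {τ : Fin k' → Obj Σ' k''} {τ' : Fin k → Obj Σ' k''} →
              (∀ i → homO τ (σ i) ≡ τ' i) → ∀ i → homO (exts τ) (exts σ i) ≡ exts τ' i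
  exts-homO h zero = refl
  exts-homO {σ = σ} {τ} h (suc i) =
    trans (homO-renO {τ' = renO suc ∘ τ} (λ _ → refl) (σ i)) (trans (sym (renO-homO (λ _ → refl) (σ i))) (cong (renO suc) (h i)))

  homO-subO : {σ : Sub {Σ} k k'} {τ : Fin k' → Obj Σ' k''} {τ' : Fin k → Obj Σ' k''} →
              (∀ i → homO τ (σ i) ≡ τ' i) → (M : Obj Σ k) → homO τ (subO σ M) ≡ homO τ' M
  homT-subT : {σ : Sub {Σ} k k'} {τ : Fin k' → Obj Σ' k''} {τ' : Fin k → Obj Σ' k''} →
              (∀ i → homO τ (σ i) ≡ τ' i) → (A : Ty Σ k) → homT τ (subT σ A) ≡ homT τ' A
  homO-subO h (var i)   = h i
  homO-subO h (con c)   = refl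
  homO-subO h (lam A M) = cong₂ lam (homT-subT h A) (homO-subO (exts-homO h) M)
  homO-subO h (app M N) = cong₂ app (homO-subO h M) (homO-subO h N)
  homT-subT h (tcon a)   = refl
  homT-subT h (Pi A B)   = cong₂ Pi (homT-subT h A) (homT-subT (exts-homO h) B)
  homT-subT h (tlam A B) = cong₂ tlam (homT-subT h A) (homT-subT (exts-homO h) B)
  homT-subT h (tapp A M) = cong₂ tapp (homT-subT h A) (homO-subO h M)

  homO-sg : (τ : Fin k → Obj Σ' k') (N : Obj Σ k) → ∀ i → subO (sg (homO τ N)) (exts τ i) ≡ homO τ (sg N i)
  homO-sg τ N zero    = refl
  homO-sg τ N (suc i) = sg-renO (homO τ N) (τ i)

  homO-as-subO : (τ : Fin k → Obj Σ' k') (M : Obj Σ k) → homO τ M ≡ subO τ (mO id M)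
  homO-as-subO τ M = sym (trans (cong (subO τ) (mO-homO (λ _ → refl) M)) (subO-homO (λ _ → refl) M))

  homT-as-subT : (τ : Fin k → Obj Σ' k') (A : Ty Σ k) → homT τ A ≡ subT τ (mT id A)
  homT-as-subT τ A = sym (trans (cong (subT τ) (mT-homT (λ _ → refl) A)) (subT-homT (λ _ → refl) A))

module MorphismConv (v : Variant) {S T : Theory} (μ : Morphism v S T) where
  open HomProperties (mc μ) (ma μ) public
  open Conv v T
  open ConvProperties v T
  private
    module S = Conv v S
    variable k k' : ℕ

  homO-↪O : {M M' : Obj (sig S) k} → M S.↪O M' → (τ : Fin k → Obj (sig T) k') → homO τ M ≡O homO τ M'
  homT-↪T : {A A' : Ty (sig S) k} → A S.↪T A' → (τ : Fin k → Obj (sig T) k') → homT τ A ≡T homT τ A'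
  homO-↪O (S.β {M = M} {N}) τ =
    return β ◅◅ ≡O-reflexive (trans (subO-homO (homO-sg τ N) M) (sym (homO-subO (λ _ → refl) M)))
  homO-↪O (S.η A {M} e) τ =
    return (η (homT τ A) e) ◅◅ ≡O-reflexive (cong (λ X → lam (homT τ A) (app X (var zero)))
      (trans (renO-homO (λ _ → refl) M) (sym (homO-renO (λ _ → refl) M))))
  homO-↪O (S.rule {l = l} {r} l↪r σ) τ =
    ≡O-reflexive (homO-subO-as-subO l) ◅◅ subO-≡O θ (rules-pres μ l↪r) ◅◅ ≡O-sym (≡O-reflexive (homO-subO-as-subO r))
    where
      θ = homO τ ∘ σ
      homO-subO-as-subO : ∀ M → homO τ (subO σ M) ≡ subO θ (Hom.mO (mc μ) (ma μ) id M)
      homO-subO-as-subO M = trans (homO-subO (λ _ → refl) M) (homO-as-subO θ M)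
  homO-↪O (S.lamA s) τ = lam-≡O (homT-↪T s τ) ◅-refl
  homO-↪O (S.lamM s) τ = lam-≡O ◅-refl (homO-↪O s (exts τ))
  homO-↪O (S.appL s) τ = app-≡O (homO-↪O s τ) ◅-refl
  homO-↪O (S.appR s) τ = app-≡O ◅-refl (homO-↪O s τ)
  homT-↪T (S.β {B = B} {N}) τ =
    return β ◅◅ ≡T-reflexive (trans (subT-homT (homO-sg τ N) B) (sym (homT-subT (λ _ → refl) B)))
  homT-↪T (S.η A {B} e) τ =
    return (η (homT τ A) e) ◅◅ ≡T-reflexive (cong (λ X → tlam (homT τ A) (tapp X (var zero)))
      (trans (renT-homT (λ _ → refl) B) (sym (homT-renT (λ _ → refl) B))))
  homT-↪T (S.rule {l = l} {r} l↪r σ) τ =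
    ≡T-reflexive (homT-subT-as-subT l) ◅◅ subT-≡T θ (rules-pres μ l↪r) ◅◅ ≡T-sym (≡T-reflexive (homT-subT-as-subT r))
    where
      θ = homO τ ∘ σ
      homT-subT-as-subT : ∀ A → homT τ (subT σ A) ≡ subT θ (Hom.mT (mc μ) (ma μ) id A)
      homT-subT-as-subT A = trans (homT-subT (λ _ → refl) A) (homT-as-subT θ A)
  homT-↪T (S.PiA s)   τ = Pi-≡T (homT-↪T s τ) ◅-refl
  homT-↪T (S.PiB s)   τ = Pi-≡T ◅-refl (homT-↪T s (exts τ))
  homT-↪T (S.tlamA s) τ = tlam-≡T (homT-↪T s τ) ◅-refl
  homT-↪T (S.tlamB s) τ = tlam-≡T ◅-refl (homT-↪T s (exts τ))
  homT-↪T (S.tappL s) τ = tapp-≡T (homT-↪T s τ) ◅-refl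
  homT-↪T (S.tappR s) τ = tapp-≡T ◅-refl (homO-↪O s τ)

module LogicalRelation (v : Variant) {S T : Theory} {n : ℕ} (μ : Fin n → Morphism v S T)
                       (lc : Fin (nc (sig S)) → Obj (sig T) 0) (la : Fin (na (sig S)) → Ty (sig T) 0) where
  open LR μ lc la
  private
    module μⱼ (j : Fin n) = MorphismConv v (μ j)
    variable k k' k'' : ℕ

  homOⱼ : Fin n → (Fin k → Obj ΣT k') → Obj ΣS k → Obj ΣT k'
  homOⱼ j = μⱼ.homO j

  homTⱼ : Fin n → (Fin k → Obj ΣT k') → Ty ΣS k → Ty ΣT k'
  homTⱼ j = μⱼ.homT j

  -- relO σ generalises λ: the environment σ gives, for each source variable x, target terms
  -- for x* and x₁,…,xₙ.  λ itself is relO (varₑ (canon k)), and the paper's λ(θ) is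
  -- relSub (varₑ (canon k)) θ.
  record Env (k k' : ℕ) : Set where
    constructor env
    field
      starₑ : Fin k → Obj ΣT k'
      compₑ : Fin n → Fin k → Obj ΣT k'
  open Env public

  varₑ : LRen k k' → Env k k'
  varₑ ρ = env (var ∘ star ρ) (λ j → var ∘ comp ρ j)

  renₑ : Ren k' k'' → Env k k' → Env k k''
  renₑ r σ = env (renO r ∘ starₑ σ) (λ j → renO r ∘ compₑ σ j)

  wkₑ : Env k k' → Env k (n + k')
  wkₑ = renₑ (n ↑ʳ_)

  up : Ren k' (suc (n + k'))
  up = suc n ↑ʳ_

  liftₑ : Env k k' → Env (suc k) (suc (n + k'))
  starₑ (liftₑ σ) zero      = var zero
  starₑ (liftₑ σ) (suc i)   = renO up (starₑ σ i)
  compₑ (liftₑ σ) j zero    = var (suc (xvar j))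
  compₑ (liftₑ σ) j (suc i) = renO up (compₑ σ j i)

  telₑ : Env k k' → Ty ΣS k → Tel ΣT k' n
  telₑ σ A = mkTel n (λ j r → homTⱼ j (renO r ∘ compₑ σ j) A)

  -- the arguments (f₁ x₁) ⋯ (fₙ xₙ) of λ(B) in λ(Πx:A.B)
  fxs : Fin n → Obj ΣT (suc (n + (n + k')))
  fxs j = app (var (suc (n ↑ʳ xvar j))) (var (suc (xvar j)))

  relO : Env k k' → Obj ΣS k → Obj ΣT k'
  relT : Env k k' → Ty ΣS k → Ty ΣT k'
  relO σ (var i)   = starₑ σ i
  relO σ (con c)   = wk0O (lc c)
  relO σ (lam A M) = lamsO (telₑ σ A) (lam (tappsT (relT (wkₑ σ) A) xs) (relO (liftₑ σ) M))
  relO σ (app M N) = app (appsO (relO σ M) (λ j → homOⱼ j (compₑ σ j) N)) (relO σ N)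
  relT σ (tcon a)   = wk0T (la a)
  relT σ (Pi A B)   =
    tlamsT (telₑ σ (Pi A B))
      (pisT (telₑ (wkₑ σ) A)
        (Pi (tappsT (relT (wkₑ (wkₑ σ)) A) xs) (tappsT (relT (liftₑ (wkₑ σ)) B) fxs)))
  relT σ (tlam A B) = tlamsT (telₑ σ A) (tlam (tappsT (relT (wkₑ σ) A) xs) (relT (liftₑ σ) B))
  relT σ (tapp A M) = tapp (tappsT (relT σ A) (λ j → homOⱼ j (compₑ σ j) M)) (relO σ M)

  relSub : Env k' k'' → Sub {ΣS} k k' → Env k k''
  relSub σ θ = env (relO σ ∘ θ) (λ j → homOⱼ j (compₑ σ j) ∘ θ)

  record VarAgrees (ρ : LRen k k') (σ : Env k k') : Set where
    constructor _,_
    field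
      star≡ : ∀ i → var (star ρ i) ≡ starₑ σ i
      comp≡ : ∀ j i → var (comp ρ j i) ≡ compₑ σ j i
  open VarAgrees public

  VarAgrees-wk : {ρ : LRen k k'} {σ : Env k k'} → VarAgrees ρ σ → VarAgrees (wkLR ρ) (wkₑ σ)
  VarAgrees-wk h = (λ i → cong (renO (n ↑ʳ_)) (star≡ h i)) , (λ j i → cong (renO (n ↑ʳ_)) (comp≡ h j i))

  VarAgrees-lift : {ρ : LRen k k'} {σ : Env k k'} → VarAgrees ρ σ → VarAgrees (liftLR ρ) (liftₑ σ)
  VarAgrees-lift {ρ = ρ} {σ} h = star≡′ , comp≡′
    where
      star≡′ : ∀ i → var (star (liftLR ρ) i) ≡ starₑ (liftₑ σ) i
      star≡′ zero    = refl
      star≡′ (suc i) = cong (renO up) (star≡ h i)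
      comp≡′ : ∀ j i → var (comp (liftLR ρ) j i) ≡ compₑ (liftₑ σ) j i
      comp≡′ j zero    = refl
      comp≡′ j (suc i) = cong (renO up) (comp≡ h j i)

  telμ-telₑ : {ρ : LRen k k'} {σ : Env k k'} → VarAgrees ρ σ → (A : Ty ΣS k) → telμ ρ A ≡ telₑ σ A
  telμ-telₑ h A = mkTel-cong n (λ j r → μⱼ.mT-homT j (λ i → cong (renO r) (comp≡ h j i)) A)

  lO-relO : {ρ : LRen k k'} {σ : Env k k'} → VarAgrees ρ σ → (M : Obj ΣS k) → lO ρ M ≡ relO σ M
  lT-relT : {ρ : LRen k k'} {σ : Env k k'} → VarAgrees ρ σ → (A : Ty ΣS k) → lT ρ A ≡ relT σ A
  lO-relO h (var i)   = star≡ h i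
  lO-relO h (con c)   = refl
  lO-relO h (lam A M) =
    cong₂ lamsO (telμ-telₑ h A)
      (cong₂ lam (cong (λ X → tappsT X xs) (lT-relT (VarAgrees-wk h) A)) (lO-relO (VarAgrees-lift h) M))
  lO-relO h (app M N) = cong₂ app (appsO-cong (lO-relO h M) (λ j → μⱼ.mO-homO j (comp≡ h j) N)) (lO-relO h N)
  lT-relT h (tcon a)   = refl
  lT-relT h (Pi A B)   =
    cong₂ tlamsT (telμ-telₑ h (Pi A B)) (cong₂ pisT (telμ-telₑ (VarAgrees-wk h) A)
      (cong₂ Pi (cong (λ X → tappsT X xs) (lT-relT (VarAgrees-wk (VarAgrees-wk h)) A))
                (cong (λ X → tappsT X fxs) (lT-relT (VarAgrees-lift (VarAgrees-wk h)) B))))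
  lT-relT h (tlam A B) =
    cong₂ tlamsT (telμ-telₑ h A)
      (cong₂ tlam (cong (λ X → tappsT X xs) (lT-relT (VarAgrees-wk h) A)) (lT-relT (VarAgrees-lift h) B))
  lT-relT h (tapp A M) = cong₂ tapp (tappsT-cong (lT-relT h A) (λ j → μⱼ.mO-homO j (comp≡ h j) M)) (lO-relO h M)

  record RenAgrees (σ : Env k' k'') (r : Ren k k') (σ' : Env k k'') : Set where
    constructor _,_
    field
      star≡ : ∀ i → starₑ σ (r i) ≡ starₑ σ' i
      comp≡ : ∀ j i → compₑ σ j (r i) ≡ compₑ σ' j i
  open RenAgrees public

  RenAgrees-wk : {σ : Env k' k''} {r : Ren k k'} {σ' : Env k k''} → RenAgrees σ r σ' → RenAgrees (wkₑ σ) r (wkₑ σ')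
  RenAgrees-wk h = (λ i → cong (renO (n ↑ʳ_)) (star≡ h i)) , (λ j i → cong (renO (n ↑ʳ_)) (comp≡ h j i))

  RenAgrees-lift : {σ : Env k' k''} {r : Ren k k'} {σ' : Env k k''} →
                   RenAgrees σ r σ' → RenAgrees (liftₑ σ) (ext r) (liftₑ σ')
  RenAgrees-lift {σ = σ} {r} {σ'} h = star≡′ , comp≡′
    where
      star≡′ : ∀ i → starₑ (liftₑ σ) (ext r i) ≡ starₑ (liftₑ σ') i
      star≡′ zero    = refl
      star≡′ (suc i) = cong (renO up) (star≡ h i)
      comp≡′ : ∀ j i → compₑ (liftₑ σ) j (ext r i) ≡ compₑ (liftₑ σ') j i
      comp≡′ j zero    = refl
      comp≡′ j (suc i) = cong (renO up) (comp≡ h j i)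

  telₑ-renT : {σ : Env k' k''} {r : Ren k k'} {σ' : Env k k''} → RenAgrees σ r σ' →
              (A : Ty ΣS k) → telₑ σ (renT r A) ≡ telₑ σ' A
  telₑ-renT h A = mkTel-cong n (λ j r → μⱼ.homT-renT j (λ i → cong (renO r) (comp≡ h j i)) A)

  relO-renO : {σ : Env k' k''} {r : Ren k k'} {σ' : Env k k''} → RenAgrees σ r σ' →
              (M : Obj ΣS k) → relO σ (renO r M) ≡ relO σ' M
  relT-renT : {σ : Env k' k''} {r : Ren k k'} {σ' : Env k k''} → RenAgrees σ r σ' →
              (A : Ty ΣS k) → relT σ (renT r A) ≡ relT σ' A
  relO-renO h (var i)   = star≡ h i
  relO-renO h (con c)   = refl
  relO-renO h (lam A M) =
    cong₂ lamsO (telₑ-renT h A)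
      (cong₂ lam (cong (λ X → tappsT X xs) (relT-renT (RenAgrees-wk h) A)) (relO-renO (RenAgrees-lift h) M))
  relO-renO h (app M N) = cong₂ app (appsO-cong (relO-renO h M) (λ j → μⱼ.homO-renO j (comp≡ h j) N)) (relO-renO h N)
  relT-renT h (tcon a)   = refl
  relT-renT h (Pi A B)   =
    cong₂ tlamsT (telₑ-renT h (Pi A B)) (cong₂ pisT (telₑ-renT (RenAgrees-wk h) A)
      (cong₂ Pi (cong (λ X → tappsT X xs) (relT-renT (RenAgrees-wk (RenAgrees-wk h)) A))
                (cong (λ X → tappsT X fxs) (relT-renT (RenAgrees-lift (RenAgrees-wk h)) B))))
  relT-renT h (tlam A B) =
    cong₂ tlamsT (telₑ-renT h A)
      (cong₂ tlam (cong (λ X → tappsT X xs) (relT-renT (RenAgrees-wk h) A)) (relT-renT (RenAgrees-lift h) B))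
  relT-renT h (tapp A M) = cong₂ tapp (tappsT-cong (relT-renT h A) (λ j → μⱼ.homO-renO j (comp≡ h j) M)) (relO-renO h M)

  record SubAgrees (s : Sub {ΣT} k' k'') (σ : Env k k') (σ' : Env k k'') : Set where
    constructor _,_
    field
      star≡ : ∀ i → subO s (starₑ σ i) ≡ starₑ σ' i
      comp≡ : ∀ j i → subO s (compₑ σ j i) ≡ compₑ σ' j i
  open SubAgrees public

  SubAgrees-wk : {s : Sub {ΣT} k' k''} {σ : Env k k'} {σ' : Env k k''} →
                 SubAgrees s σ σ' → SubAgrees (extsⁿ n s) (wkₑ σ) (wkₑ σ')
  SubAgrees-wk {s = s} {σ} h =
    (λ i → trans (subO-renO-↑ʳ n s (starₑ σ i)) (cong (renO (n ↑ʳ_)) (star≡ h i))) ,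
    (λ j i → trans (subO-renO-↑ʳ n s (compₑ σ j i)) (cong (renO (n ↑ʳ_)) (comp≡ h j i)))

  SubAgrees-lift : {s : Sub {ΣT} k' k''} {σ : Env k k'} {σ' : Env k k''} →
                   SubAgrees s σ σ' → SubAgrees (exts (extsⁿ n s)) (liftₑ σ) (liftₑ σ')
  SubAgrees-lift {s = s} {σ} {σ'} h = star≡′ , comp≡′
    where
      star≡′ : ∀ i → subO (exts (extsⁿ n s)) (starₑ (liftₑ σ) i) ≡ starₑ (liftₑ σ') i
      star≡′ zero    = refl
      star≡′ (suc i) = trans (subO-renO-↑ʳ (suc n) s (starₑ σ i)) (cong (renO up) (star≡ h i))
      comp≡′ : ∀ j i → subO (exts (extsⁿ n s)) (compₑ (liftₑ σ) j i) ≡ compₑ (liftₑ σ') j i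
      comp≡′ j zero    = cong (renO suc) (extsⁿ-↑ˡ n s (opposite j))
      comp≡′ j (suc i) = trans (subO-renO-↑ʳ (suc n) s (compₑ σ j i)) (cong (renO up) (comp≡ h j i))

  subTel-telₑ : {s : Sub {ΣT} k' k''} {σ : Env k k'} {σ' : Env k k''} → SubAgrees s σ σ' →
                (A : Ty ΣS k) → subTel s (telₑ σ A) ≡ telₑ σ' A
  subTel-telₑ {s = s} {σ} h A =
    subTel-mkTel n s (λ j p → μⱼ.subT-homT j (λ i → trans (subO-renO-↑ʳ p s (compₑ σ j i)) (cong (renO (p ↑ʳ_)) (comp≡ h j i))) A)

  fxs-subO : (s : Sub {ΣT} k' k'') (j : Fin n) → subO (exts (extsⁿ n (extsⁿ n s))) (fxs j) ≡ fxs j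
  fxs-subO s j =
    cong₂ app (cong (renO suc) (trans (extsⁿ-↑ʳ n (extsⁿ n s) (xvar j)) (cong (renO (n ↑ʳ_)) (extsⁿ-↑ˡ n s (opposite j)))))
              (cong (renO suc) (extsⁿ-↑ˡ n (extsⁿ n s) (opposite j)))

  subO-relO : {s : Sub {ΣT} k' k''} {σ : Env k k'} {σ' : Env k k''} → SubAgrees s σ σ' →
              (M : Obj ΣS k) → subO s (relO σ M) ≡ relO σ' M
  subT-relT : {s : Sub {ΣT} k' k''} {σ : Env k k'} {σ' : Env k k''} → SubAgrees s σ σ' →
              (A : Ty ΣS k) → subT s (relT σ A) ≡ relT σ' A
  subO-relO h (var i)   = star≡ h i
  subO-relO {s = s} h (con c) = subO-wk0O s (lc c)
  subO-relO {s = s} {σ} h (lam A M) =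
    trans (lamsO-subO s (telₑ σ A) _)
      (cong₂ lamsO (subTel-telₑ h A)
        (cong₂ lam (trans (tappsT-telVars-subT n s (relT (wkₑ σ) A)) (cong (λ X → tappsT X xs) (subT-relT (SubAgrees-wk h) A)))
                   (subO-relO (SubAgrees-lift h) M)))
  subO-relO {s = s} {σ} h (app M N) =
    cong₂ app (trans (appsO-subO s (relO σ M) (λ j → homOⱼ j (compₑ σ j) N))
                     (appsO-cong (subO-relO h M) (λ j → μⱼ.subO-homO j (comp≡ h j) N)))
              (subO-relO h N)
  subT-relT {s = s} h (tcon a) = subT-wk0T s (la a)
  subT-relT {s = s} {σ} h (Pi A B) =
    trans (tlamsT-subT s (telₑ σ (Pi A B)) _) (cong₂ tlamsT (subTel-telₑ h (Pi A B))
      (trans (pisT-subT (extsⁿ n s) (telₑ (wkₑ σ) A) _) (cong₂ pisT (subTel-telₑ (SubAgrees-wk h) A)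
        (cong₂ Pi
          (trans (tappsT-telVars-subT n (extsⁿ n s) (relT (wkₑ (wkₑ σ)) A))
                 (cong (λ X → tappsT X xs) (subT-relT (SubAgrees-wk (SubAgrees-wk h)) A)))
          (trans (tappsT-subT (exts (extsⁿ n (extsⁿ n s))) (relT (liftₑ (wkₑ σ)) B) fxs)
                 (tappsT-cong (subT-relT (SubAgrees-lift (SubAgrees-wk h)) B) (fxs-subO s)))))))
  subT-relT {s = s} {σ} h (tlam A B) =
    trans (tlamsT-subT s (telₑ σ A) _)
      (cong₂ tlamsT (subTel-telₑ h A)
        (cong₂ tlam (trans (tappsT-telVars-subT n s (relT (wkₑ σ) A)) (cong (λ X → tappsT X xs) (subT-relT (SubAgrees-wk h) A)))
                    (subT-relT (SubAgrees-lift h) B)))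
  subT-relT {s = s} {σ} h (tapp A M) =
    cong₂ tapp (trans (tappsT-subT s (relT σ A) (λ j → homOⱼ j (compₑ σ j) M))
                      (tappsT-cong (subT-relT h A) (λ j → μⱼ.subO-homO j (comp≡ h j) M)))
               (subO-relO h M)

  renO-relO : (r : Ren k' k'') (σ : Env k k') (M : Obj ΣS k) → renO r (relO σ M) ≡ relO (renₑ r σ) M
  renO-relO r σ M = trans (sym (subO-var {ρ = r} (λ _ → refl) (relO σ M))) (subO-relO var∘r-agrees M)
    where
      var∘r-agrees : SubAgrees (var ∘ r) σ (renₑ r σ)
      var∘r-agrees = (λ i → subO-var (λ _ → refl) (starₑ σ i)) , (λ j i → subO-var (λ _ → refl) (compₑ σ j i))

  renT-relT : (r : Ren k' k'') (σ : Env k k') (A : Ty ΣS k) → renT r (relT σ A) ≡ relT (renₑ r σ) A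
  renT-relT r σ A = trans (sym (subT-var {ρ = r} (λ _ → refl) (relT σ A))) (subT-relT var∘r-agrees A)
    where
      var∘r-agrees : SubAgrees (var ∘ r) σ (renₑ r σ)
      var∘r-agrees = (λ i → subO-var (λ _ → refl) (starₑ σ i)) , (λ j i → subO-var (λ _ → refl) (compₑ σ j i))

  relO-liftₑ-renO : (σ : Env k k') (M : Obj ΣS k) → relO (liftₑ σ) (renO suc M) ≡ renO up (relO σ M)
  relO-liftₑ-renO σ M = trans (relO-renO ((λ _ → refl) , (λ _ _ → refl)) M) (sym (renO-relO up σ M))

  relT-liftₑ-renT : (σ : Env k k') (A : Ty ΣS k) → relT (liftₑ σ) (renT suc A) ≡ renT up (relT σ A)
  relT-liftₑ-renT σ A = trans (relT-renT ((λ _ → refl) , (λ _ _ → refl)) A) (sym (renT-relT up σ A))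

  homOⱼ-liftₑ-renO : (j : Fin n) (σ : Env k k') (M : Obj ΣS k) →
                     homOⱼ j (compₑ (liftₑ σ) j) (renO suc M) ≡ renO up (homOⱼ j (compₑ σ j) M)
  homOⱼ-liftₑ-renO j σ M =
    trans (μⱼ.homO-renO j {τ' = renO up ∘ compₑ σ j} (λ _ → refl) M) (sym (μⱼ.renO-homO j (λ _ → refl) M))

  record RelSubAgrees (σ : Env k' k'') (θ : Sub {ΣS} k k') (σ' : Env k k'') : Set where
    constructor _,_
    field
      star≡ : ∀ i → relO σ (θ i) ≡ starₑ σ' i
      comp≡ : ∀ j i → homOⱼ j (compₑ σ j) (θ i) ≡ compₑ σ' j i
  open RelSubAgrees public

  relSub-agrees : {σ : Env k' k''} {θ : Sub {ΣS} k k'} → RelSubAgrees σ θ (relSub σ θ)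
  relSub-agrees = (λ _ → refl) , (λ _ _ → refl)

  RelSubAgrees-wk : {σ : Env k' k''} {θ : Sub {ΣS} k k'} {σ' : Env k k''} →
                    RelSubAgrees σ θ σ' → RelSubAgrees (wkₑ σ) θ (wkₑ σ')
  RelSubAgrees-wk {σ = σ} {θ} h =
    (λ i → trans (sym (renO-relO (n ↑ʳ_) σ (θ i))) (cong (renO (n ↑ʳ_)) (star≡ h i))) ,
    (λ j i → trans (sym (μⱼ.renO-homO j (λ _ → refl) (θ i))) (cong (renO (n ↑ʳ_)) (comp≡ h j i)))

  RelSubAgrees-lift : {σ : Env k' k''} {θ : Sub {ΣS} k k'} {σ' : Env k k''} →
                      RelSubAgrees σ θ σ' → RelSubAgrees (liftₑ σ) (exts θ) (liftₑ σ')
  RelSubAgrees-lift {σ = σ} {θ} {σ'} h = star≡′ , comp≡′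
    where
      star≡′ : ∀ i → relO (liftₑ σ) (exts θ i) ≡ starₑ (liftₑ σ') i
      star≡′ zero    = refl
      star≡′ (suc i) = trans (relO-liftₑ-renO σ (θ i)) (cong (renO up) (star≡ h i))
      comp≡′ : ∀ j i → homOⱼ j (compₑ (liftₑ σ) j) (exts θ i) ≡ compₑ (liftₑ σ') j i
      comp≡′ j zero    = refl
      comp≡′ j (suc i) = trans (homOⱼ-liftₑ-renO j σ (θ i)) (cong (renO up) (comp≡ h j i))

  telₑ-subT : {σ : Env k' k''} {θ : Sub {ΣS} k k'} {σ' : Env k k''} → RelSubAgrees σ θ σ' →
              (A : Ty ΣS k) → telₑ σ (subT θ A) ≡ telₑ σ' A
  telₑ-subT {θ = θ} h A =
    mkTel-cong n (λ j r → μⱼ.homT-subT j (λ i → trans (sym (μⱼ.renO-homO j (λ _ → refl) (θ i))) (cong (renO r) (comp≡ h j i))) A)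

  relO-subO : {σ : Env k' k''} {θ : Sub {ΣS} k k'} {σ' : Env k k''} → RelSubAgrees σ θ σ' →
              (M : Obj ΣS k) → relO σ (subO θ M) ≡ relO σ' M
  relT-subT : {σ : Env k' k''} {θ : Sub {ΣS} k k'} {σ' : Env k k''} → RelSubAgrees σ θ σ' →
              (A : Ty ΣS k) → relT σ (subT θ A) ≡ relT σ' A
  relO-subO h (var i)   = star≡ h i
  relO-subO h (con c)   = refl
  relO-subO h (lam A M) =
    cong₂ lamsO (telₑ-subT h A)
      (cong₂ lam (cong (λ X → tappsT X xs) (relT-subT (RelSubAgrees-wk h) A)) (relO-subO (RelSubAgrees-lift h) M))
  relO-subO h (app M N) = cong₂ app (appsO-cong (relO-subO h M) (λ j → μⱼ.homO-subO j (comp≡ h j) N)) (relO-subO h N)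
  relT-subT h (tcon a)   = refl
  relT-subT h (Pi A B)   =
    cong₂ tlamsT (telₑ-subT h (Pi A B)) (cong₂ pisT (telₑ-subT (RelSubAgrees-wk h) A)
      (cong₂ Pi (cong (λ X → tappsT X xs) (relT-subT (RelSubAgrees-wk (RelSubAgrees-wk h)) A))
                (cong (λ X → tappsT X fxs) (relT-subT (RelSubAgrees-lift (RelSubAgrees-wk h)) B))))
  relT-subT h (tlam A B) =
    cong₂ tlamsT (telₑ-subT h A)
      (cong₂ tlam (cong (λ X → tappsT X xs) (relT-subT (RelSubAgrees-wk h) A)) (relT-subT (RelSubAgrees-lift h) B))
  relT-subT h (tapp A M) = cong₂ tapp (tappsT-cong (relT-subT h A) (λ j → μⱼ.homO-subO j (comp≡ h j) M)) (relO-subO h M)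

  βSub : Env k k' → Obj ΣS k → Sub {ΣT} (suc (n + k')) k'
  βSub σ N = subO (sg (relO σ N)) ∘ exts (telSub n (λ j → homOⱼ j (compₑ σ j) N))

  β-agrees : (σ : Env k k') (N : Obj ΣS k) → SubAgrees (βSub σ N) (liftₑ σ) (relSub σ (sg N))
  β-agrees {k' = k'} σ N = star≡′ , comp≡′
    where
      args = λ j → homOⱼ j (compₑ σ j) N
      βSub-up : ∀ p → βSub σ N (up p) ≡ var p
      βSub-up p = trans (sg-renO (relO σ N) (telSub n args (n ↑ʳ p))) (telSub-↑ʳ n args p)
      βSub-renO-up : ∀ X → subO (βSub σ N) (renO up X) ≡ X
      βSub-renO-up X = trans (subO-renO βSub-up X) (subO-id (λ _ → refl) X)
      star≡′ : ∀ i → subO (βSub σ N) (starₑ (liftₑ σ) i) ≡ relO σ (sg N i)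
      star≡′ zero    = refl
      star≡′ (suc i) = βSub-renO-up (starₑ σ i)
      comp≡′ : ∀ j i → subO (βSub σ N) (compₑ (liftₑ σ) j i) ≡ homOⱼ j (compₑ σ j) (sg N i)
      comp≡′ j zero    = trans (sg-renO (relO σ N) (telSub n args (xvar j)))
                               (trans (telSub-↑ˡ n args (opposite j)) (cong args (opposite-involutive j)))
      comp≡′ j (suc i) = βSub-renO-up (compₑ σ j i)

  varₑ-agrees : {ρ : LRen k k'} → VarAgrees ρ (varₑ ρ)
  varₑ-agrees = (λ _ → refl) , (λ _ _ → refl)

  tailₑ : Env (suc k) k' → Env k k'
  tailₑ σ = env (starₑ σ ∘ suc) (λ j → compₑ σ j ∘ suc)

  -- canon m lays out the L m target variables; toSub m σ sends the slot of x* to starₑ σ x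
  -- and the slot of xⱼ to compₑ σ j x.
  toSub : ∀ m → Env m k' → Sub {ΣT} (L m) k'
  toSub (suc m) σ zero    = starₑ σ zero
  toSub (suc m) σ (suc p) = [ (λ q → compₑ σ (opposite q) zero) , toSub m (tailₑ σ) ]′ (splitAt n p)

  toSub-canon : ∀ m (σ : Env m k') → SubAgrees (toSub m σ) (varₑ (canon m)) σ
  toSub-canon zero    σ = (λ ()) , (λ j ())
  toSub-canon (suc m) σ = star≡′ , comp≡′
    where
      star≡′ : ∀ i → toSub (suc m) σ (star (canon (suc m)) i) ≡ starₑ σ i
      star≡′ zero = refl
      star≡′ (suc i) rewrite splitAt-↑ʳ n (L m) (star (canon m) i) = star≡ (toSub-canon m (tailₑ σ)) i
      comp≡′ : ∀ j i → toSub (suc m) σ (comp (canon (suc m)) j i) ≡ compₑ σ j i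
      comp≡′ j zero    rewrite splitAt-↑ˡ n (opposite j) (L m) = cong (λ q → compₑ σ q zero) (opposite-involutive j)
      comp≡′ j (suc i) rewrite splitAt-↑ʳ n (L m) (comp (canon m) j i) = comp≡ (toSub-canon m (tailₑ σ)) j i

  relO-as-subO : ∀ {m} (σ : Env m k') (M : Obj ΣS m) → relO σ M ≡ subO (toSub m σ) (λO M)
  relO-as-subO {m = m} σ M = sym (trans (cong (subO (toSub m σ)) (lO-relO varₑ-agrees M)) (subO-relO (toSub-canon m σ) M))

  relT-as-subT : ∀ {m} (σ : Env m k') (A : Ty ΣS m) → relT σ A ≡ subT (toSub m σ) (λT A)
  relT-as-subT {m = m} σ A = sym (trans (cong (subT (toSub m σ)) (lT-relT varₑ-agrees A)) (subT-relT (toSub-canon m σ) A))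

  module Preservation (isLR : IsLogicalRelation) where
    open IsLogicalRelation isLR
    open Conv v T
    open ConvProperties v T
    private
      module S = Conv v S

    telₑ-↪T : {A A' : Ty ΣS k} → A S.↪T A' → (σ : Env k k') → telₑ σ A ≡Tel telₑ σ A'
    telₑ-↪T s σ = mkTel-≡Tel n (λ j r → μⱼ.homT-↪T j s (renO r ∘ compₑ σ j))

    relO-β : (σ : Env k k') (A : Ty ΣS k) (M : Obj ΣS (suc k)) (N : Obj ΣS k) →
             relO σ (app (lam A M) N) ≡O relO σ (subO (sg N) M)
    relO-β σ A M N = begin
      relO σ (app (lam A M) N)
        ≈⟨ app-≡O (appsO-lamsO-β (telₑ σ A) _ args) ◅-refl ⟩
      app (lam _ (subO (exts (telSub n args)) (relO (liftₑ σ) M))) (relO σ N)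
        ≈⟨ return β ⟩
      subO (sg (relO σ N)) (subO (exts (telSub n args)) (relO (liftₑ σ) M))
        ≡⟨ subO-subO (λ _ → refl) (relO (liftₑ σ) M) ⟩
      subO (βSub σ N) (relO (liftₑ σ) M)
        ≡⟨ subO-relO (β-agrees σ N) M ⟩
      relO (relSub σ (sg N)) M
        ≡⟨ relO-subO relSub-agrees M ⟨
      relO σ (subO (sg N) M) ∎
      where
        open ≡O-Reasoning
        args = λ j → homOⱼ j (compₑ σ j) N

    relT-β : (σ : Env k k') (A : Ty ΣS k) (B : Ty ΣS (suc k)) (N : Obj ΣS k) →
             relT σ (tapp (tlam A B) N) ≡T relT σ (subT (sg N) B)
    relT-β σ A B N = begin
      relT σ (tapp (tlam A B) N)
        ≈⟨ tapp-≡T (tappsT-tlamsT-β (telₑ σ A) _ args) ◅-refl ⟩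
      tapp (tlam _ (subT (exts (telSub n args)) (relT (liftₑ σ) B))) (relO σ N)
        ≈⟨ return β ⟩
      subT (sg (relO σ N)) (subT (exts (telSub n args)) (relT (liftₑ σ) B))
        ≡⟨ subT-subT (λ _ → refl) (relT (liftₑ σ) B) ⟩
      subT (βSub σ N) (relT (liftₑ σ) B)
        ≡⟨ subT-relT (β-agrees σ N) B ⟩
      relT (relSub σ (sg N)) B
        ≡⟨ relT-subT relSub-agrees B ⟨
      relT σ (subT (sg N) B) ∎
      where
        open ≡T-Reasoning
        args = λ j → homOⱼ j (compₑ σ j) N

    relO-η : v ≡ βηR → (σ : Env k k') (A : Ty ΣS k) (M : Obj ΣS k) →
             relO σ M ≡O relO σ (lam A (app (renO suc M) (var zero)))
    relO-η e σ A M =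
      lamsO-lam-η e (telₑ σ A) Aₑ (relO σ M)
      ◅◅ ≡O-reflexive (cong (λ X → lamsO (telₑ σ A) (lam Aₑ (app (appsO X (renO suc ∘ xs)) (var zero))))
                            (sym (relO-liftₑ-renO σ M)))
      where Aₑ = tappsT (relT (wkₑ σ) A) xs

    relT-η : v ≡ βηR → (σ : Env k k') (A B : Ty ΣS k) →
             relT σ B ≡T relT σ (tlam A (tapp (renT suc B) (var zero)))
    relT-η e σ A B =
      tlamsT-tlam-η e (telₑ σ A) Aₑ (relT σ B)
      ◅◅ ≡T-reflexive (cong (λ X → tlamsT (telₑ σ A) (tlam Aₑ (tapp (tappsT X (renO suc ∘ xs)) (var zero))))
                            (sym (relT-liftₑ-renT σ B)))
      where Aₑ = tappsT (relT (wkₑ σ) A) xs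

    relO-rule : ∀ {m} {l r : Obj ΣS m} → orule m l r ∈ rules S → (σ : Env k k') (θ : Sub {ΣS} m k) →
                relO σ (subO θ l) ≡O relO σ (subO θ r)
    relO-rule {m = m} {l} {r} l↪r σ θ = begin
      relO σ (subO θ l)                  ≡⟨ relO-subO-as-subO l ⟩
      subO (toSub m (relSub σ θ)) (λO l) ≈⟨ subO-≡O (toSub m (relSub σ θ)) (rules-ok l↪r) ⟩
      subO (toSub m (relSub σ θ)) (λO r) ≡⟨ relO-subO-as-subO r ⟨
      relO σ (subO θ r)                  ∎
      where
        open ≡O-Reasoning
        relO-subO-as-subO : ∀ M → relO σ (subO θ M) ≡ subO (toSub m (relSub σ θ)) (λO M)
        relO-subO-as-subO M = trans (relO-subO relSub-agrees M) (relO-as-subO (relSub σ θ) M)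

    relT-rule : ∀ {m} {l r : Ty ΣS m} → trule m l r ∈ rules S → (σ : Env k k') (θ : Sub {ΣS} m k) →
                relT σ (subT θ l) ≡T relT σ (subT θ r)
    relT-rule {m = m} {l} {r} l↪r σ θ = begin
      relT σ (subT θ l)                  ≡⟨ relT-subT-as-subT l ⟩
      subT (toSub m (relSub σ θ)) (λT l) ≈⟨ subT-≡T (toSub m (relSub σ θ)) (rules-ok l↪r) ⟩
      subT (toSub m (relSub σ θ)) (λT r) ≡⟨ relT-subT-as-subT r ⟨
      relT σ (subT θ r)                  ∎
      where
        open ≡T-Reasoning
        relT-subT-as-subT : ∀ A → relT σ (subT θ A) ≡ subT (toSub m (relSub σ θ)) (λT A)
        relT-subT-as-subT A = trans (relT-subT relSub-agrees A) (relT-as-subT (relSub σ θ) A)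

    relO-↪O : {M M' : Obj ΣS k} → M S.↪O M' → (σ : Env k k') → relO σ M ≡O relO σ M'
    relT-↪T : {A A' : Ty ΣS k} → A S.↪T A' → (σ : Env k k') → relT σ A ≡T relT σ A'
    relO-↪O (S.β {A = A} {M} {N}) σ  = relO-β σ A M N
    relO-↪O (S.η A {M} e) σ          = relO-η e σ A M
    relO-↪O (S.rule l↪r θ) σ         = relO-rule l↪r σ θ
    relO-↪O (S.lamA s) σ =
      lamsO-≡O (telₑ-↪T s σ) (lam-≡O (tappsT-≡T {m = n} (relT-↪T s (wkₑ σ)) (λ _ → ◅-refl)) ◅-refl)
    relO-↪O (S.lamM {A = A} s) σ = lamsO-≡O (≡Tel-refl (telₑ σ A)) (lam-≡O ◅-refl (relO-↪O s (liftₑ σ)))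
    relO-↪O (S.appL s) σ = app-≡O (appsO-≡O {m = n} (relO-↪O s σ) (λ _ → ◅-refl)) ◅-refl
    relO-↪O (S.appR s) σ = app-≡O (appsO-≡O {m = n} ◅-refl (λ j → μⱼ.homO-↪O j s (compₑ σ j))) (relO-↪O s σ)
    relT-↪T (S.β {A = A} {B} {N}) σ  = relT-β σ A B N
    relT-↪T (S.η A {B} e) σ          = relT-η e σ A B
    relT-↪T (S.rule l↪r θ) σ         = relT-rule l↪r σ θ
    relT-↪T (S.PiA {B = B} s) σ =
      tlamsT-≡T (telₑ-↪T (S.PiA {B = B} s) σ)
        (pisT-≡T (telₑ-↪T s (wkₑ σ)) (Pi-≡T (tappsT-≡T {m = n} (relT-↪T s (wkₑ (wkₑ σ))) (λ _ → ◅-refl)) ◅-refl))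
    relT-↪T (S.PiB {A = A} s) σ =
      tlamsT-≡T (telₑ-↪T (S.PiB {A = A} s) σ)
        (pisT-≡T (≡Tel-refl (telₑ (wkₑ σ) A)) (Pi-≡T ◅-refl (tappsT-≡T {m = n} (relT-↪T s (liftₑ (wkₑ σ))) (λ _ → ◅-refl))))
    relT-↪T (S.tlamA s) σ =
      tlamsT-≡T (telₑ-↪T s σ) (tlam-≡T (tappsT-≡T {m = n} (relT-↪T s (wkₑ σ)) (λ _ → ◅-refl)) ◅-refl)
    relT-↪T (S.tlamB {A = A} s) σ = tlamsT-≡T (≡Tel-refl (telₑ σ A)) (tlam-≡T ◅-refl (relT-↪T s (liftₑ σ)))
    relT-↪T (S.tappL s) σ = tapp-≡T (tappsT-≡T {m = n} (relT-↪T s σ) (λ _ → ◅-refl)) ◅-refl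
    relT-↪T (S.tappR s) σ = tapp-≡T (tappsT-≡T {m = n} ◅-refl (λ j → μⱼ.homO-↪O j s (compₑ σ j))) (relO-↪O s σ)

    lT-≡T : {ρ : LRen k k'} {A B : Ty ΣS k} → A S.≡T B → lT ρ A ≡T lT ρ B
    lT-≡T {ρ = ρ} {A} {B} e =
      ≡T-reflexive (lT-relT varₑ-agrees A)
      ◅◅ gfold (EqClosure-isEquivalence _↪T_) (relT (varₑ ρ)) (λ s → relT-↪T s (varₑ ρ)) e
      ◅◅ ≡T-sym (≡T-reflexive (lT-relT varₑ-agrees B))

    telμ-↪T : {A A' : Ty ΣS k} → A S.↪T A' → (ρ : LRen k k') → telμ ρ A ≡Tel telμ ρ A'
    telμ-↪T {A = A} {A'} s ρ =
      subst₂ (_≡Tel_ {m = n}) (sym (telμ-telₑ (varₑ-agrees {ρ = ρ}) A)) (sym (telμ-telₑ (varₑ-agrees {ρ = ρ}) A')) (telₑ-↪T s (varₑ ρ))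

    lK-↪K : {K K' : Kd ΣS k} → K S.↪K K' → (ρ : LRen k k') (R : Ty ΣS k) → lK ρ R K ≡K lK ρ R K'
    lK-↪K (S.KPiA s) ρ R =
      pisK-≡K (telμ-↪T s ρ) (KPi-≡K (tappsT-≡T {m = n} (lT-≡T (return s)) (λ _ → ◅-refl)) ◅-refl)
    lK-↪K (S.KPiK {A = A} s) ρ R =
      pisK-≡K (≡Tel-refl (telμ ρ A)) (KPi-≡K ◅-refl (lK-↪K s (liftLR ρ) (tapp (renT suc R) (var zero))))

    lK-≡K : {K K' : Kd ΣS k} → K S.≡K K' → (ρ : LRen k k') (R : Ty ΣS k) → lK ρ R K ≡K lK ρ R K'
    lK-≡K e ρ R = gfold (EqClosure-isEquivalence _↪K_) (lK ρ R) (λ s → lK-↪K s ρ R) e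

mainTheorem6 : (v : Variant) (S T : Theory) (n : ℕ) (μ : Fin n → Morphism v S T)
    (lc : Fin (nc (sig S)) → Obj (sig T) 0) (la : Fin (na (sig S)) → Ty (sig T) 0) →
    LR.IsLogicalRelation μ lc la →
    ((k : ℕ) (A B : Ty (sig S) k) → Conv._≡T_ v S A B →
       Conv._≡T_ v T (LR.λT μ lc la A) (LR.λT μ lc la B))
    × ((k : ℕ) (R : Ty (sig S) k) (K K' : Kd (sig S) k) → Conv._≡K_ v S K K' →
       Conv._≡K_ v T (LR.λK μ lc la R K) (LR.λK μ lc la R K'))
mainTheorem6 v S T n μ lc la isLR =
  (λ k A B → lT-≡T {ρ = LR.canon μ lc la k}) , (λ k R K K' e → lK-≡K e (LR.canon μ lc la k) R)
  where
    open LogicalRelation v μ lc la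
    open Preservation isLR
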